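{- Let $\epsilon>0$ be a constant. In the simultaneous model with $k$ players, for graphs on $n$ vertices with average degree $d=\Omega(\sqrt n)$ (and $d\le n^{1-o(1)}$), where $d$ is known to the players and the edges are distributed among the players possibly with duplication, triangle detection can be solved with communication $O(k(nd)^{1/3}\log n)$ and constant error: for any constant $\delta>0$ there is such a protocol in which, whenever the input graph is $\epsilon$-far from triangle-free, the referee outputs a triangle of the graph with probability at least $1-\delta$.
   Context: Simultaneous model: $k$ players, player $j$ holding $E_j\subseteq E$ with $\bigcup_jE_j=E$ (not necessarily disjoint), and a referee with no input; using shared public randomness, each player sends a single message, depending only on its input and the randomness, to the referee, who then produces the output. Cost is the total number of bits sent. $G=(V,E)$ is $\epsilon$-far from triangle-free if at least $\epsilon|E|$ edges must be removed to make it triangle-free. -}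

module Defs where

open import Data.Nat using (ℕ; zero; suc; _+_; _*_; _^_; _≤_; _<_)
open import Data.Bool using (Bool; true; false; _∧_; not; if_then_else_)
open import Data.Fin using (Fin)
open import Data.Vec using (Vec; []; _∷_)
open import Data.List using (List; []; _∷_; map; length; allFin; _++_)
open import Data.Nat.ListAction using (sum)
open import Data.Maybe using (Maybe; just; nothing)
open import Data.Product using (Σ; ∃; _×_; _,_)
open import Relation.Binary.PropositionalEquality using (_≡_)

Graph : ℕ → Set
Graph n = Fin n → Fin n → Bool

IsSimple : ∀ {n} → Graph n → Set
IsSimple {n} A = (∀ (u v : Fin n) → A u v ≡ A v u) × (∀ (u : Fin n) → A u u ≡ false)

Symmetric : ∀ {n} → Graph n → Set
Symmetric {n} A = ∀ (u v : Fin n) → A u v ≡ A v u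

_⊆ᴳ_ : ∀ {n} → Graph n → Graph n → Set
_⊆ᴳ_ {n} B A = ∀ (u v : Fin n) → B u v ≡ true → A u v ≡ true

-- number of ordered adjacent pairs = 2|E| for a simple graph
pairCount : ∀ {n} → Graph n → ℕ
pairCount {n} A =
  sum (map (λ u → sum (map (λ v → if A u v then 1 else 0) (allFin n))) (allFin n))

isTriangle : ∀ {n} → Graph n → Fin n → Fin n → Fin n → Bool
isTriangle A u v w = A u v ∧ A v w ∧ A u w

HasTriangle : ∀ {n} → Graph n → Set
HasTriangle {n} A = Σ (Fin n) λ u → Σ (Fin n) λ v → Σ (Fin n) λ w → isTriangle A u v w ≡ true

removeEdges : ∀ {n} → Graph n → Graph n → Graph n
removeEdges A R u v = A u v ∧ not (R u v)

-- A is (εn/εd)-far from triangle-free: every edge set R ⊆ E with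
-- |R| < (εn/εd)|E| leaves a triangle after removal.
-- (|R| = pairCount R / 2, |E| = pairCount A / 2.)
FarFromTriangleFree : ∀ {n} → (εn εd : ℕ) → Graph n → Set
FarFromTriangleFree {n} εn εd A =
  ∀ (R : Graph n) → Symmetric R → R ⊆ᴳ A →
  εd * pairCount R < εn * pairCount A → HasTriangle (removeEdges A R)

-- all bit strings of length r (the public random string, uniform)
allVecs : ∀ r → List (Vec Bool r)
allVecs zero = [] ∷ []
allVecs (suc r) = map (true ∷_) (allVecs r) ++ map (false ∷_) (allVecs r)

countTrue : ∀ {r} → (Vec Bool r → Bool) → ℕ
countTrue {r} f = sum (map (λ ρ → if f ρ then 1 else 0) (allVecs r))

record Protocol (n k : ℕ) : Set where
  field
    r       : ℕ
    message : Fin k → Graph n → Vec Bool r → List Bool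
    referee : Vec Bool r → (Fin k → List Bool) → Maybe (Fin n × Fin n × Fin n)

open Protocol public

ValidInput : ∀ {n k} → Graph n → (Fin k → Graph n) → Set
ValidInput {n} {k} A E =
  (∀ (j : Fin k) → Symmetric (E j)) × (∀ (j : Fin k) → E j ⊆ᴳ A) ×
  (∀ (u v : Fin n) → A u v ≡ true → Σ (Fin k) λ j → E j u v ≡ true)

run : ∀ {n k} (P : Protocol n k) → (Fin k → Graph n) → Vec Bool (r P) →
      Maybe (Fin n × Fin n × Fin n)
run P E ρ = referee P ρ (λ j → message P j (E j) ρ)

cost : ∀ {n k} (P : Protocol n k) → (Fin k → Graph n) → Vec Bool (r P) → ℕ
cost {k = k} P E ρ = sum (map (λ j → length (message P j (E j) ρ)) (allFin k))

outputsTriangle : ∀ {n} → Graph n → Maybe (Fin n × Fin n × Fin n) → Bool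
outputsTriangle A (just (u , v , w)) = isTriangle A u v w
outputsTriangle A nothing = false

successCount : ∀ {n k} (P : Protocol n k) → Graph n → (Fin k → Graph n) → ℕ
successCount P A E = countTrue (λ ρ → outputsTriangle A (run P E ρ))

Vanishing : (ℕ → ℕ) → (ℕ → ℕ) → Set
Vanishing p q = ∀ (t : ℕ) → 0 < t → Σ ℕ λ M → ∀ n → M ≤ n → t * p n < q n

{-# OPTIONS --safe #-}
-- Greedily deleting triangles from a graph that is ε-far from triangle-free leaves an edge-disjoint packing
-- of τ ≥ εD/9 triangles, where D = 2|E|. The players sample every vertex independently with probability
-- 1/m, m = 2ᵇ, where L m³ ≈ D for a large constant L. Each player sends its edges inside the sample, as
-- pairs of (⌊log₂ n⌋ + 1)-bit numbers, unless there are more than M = 2δLm of them, and the referee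
-- outputs any triangle among the received edges. This succeeds unless no packed triangle is sampled or the
-- sample spans more than M edges. Two edge-disjoint triangles share at most one vertex and every vertex
-- lies in at most n packed triangles, so the second moment method bounds the first probability by
-- K/τ with K = 3nm + 9m³; Markov's inequality bounds the second by D/(m²M) ≤ δ/2. With d ≳ √n also
-- K/τ ≤ δ/2, and the cost is k · 2(⌊log₂ n⌋ + 1) · M = O(k (nd)^{1/3} log n).
module Submission where

open import Defs
open import Data.Nat using (ℕ; _+_; _*_; _^_; _≤_; _<_)
open import Data.Nat.Logarithm using (⌊log₂_⌋)
open import Data.Product using (Σ; _×_)
open import Data.Fin using (Fin)
open import Relation.Binary.PropositionalEquality using (_≡_)

open import Data.Bool using (Bool; true; false; _∧_; _∨_; not; if_then_else_)
open import Data.Bool.ListAction using (any; or)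
open import Data.Bool.Properties using (T-≡; T?; ∧-conicalˡ; ∧-conicalʳ; ∨-zeroʳ; not-injective)
open import Data.Fin using (zero; suc; _≟_; toℕ)
open import Data.Fin.Properties using (toℕ-injective; toℕ<n)
open import Data.List using (List; []; _∷_; map; length; allFin; _++_; cartesianProduct; filterᵇ; findᵇ; concatMap)
open import Data.List.Membership.Propositional using (_∈_; lose)
open import Data.List.Membership.Propositional.Properties
  using (∈-allFin; ∈-cartesianProduct⁺; ∈-filter⁺; ∈-filter⁻; ∈-map⁺; ∈-map⁻; ∈-concatMap⁺; ∈-concatMap⁻)
open import Data.List.Properties using (map-++; map-∘; map-cong; map-tabulate; length-++; length-map; length-tabulate)
open import Data.List.Relation.Unary.Any using (here; there; satisfied)
open import Data.Maybe using (Maybe; just)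
open import Data.Nat using (zero; suc; z≤n; s≤s; _<ᵇ_; _≤ᵇ_; _≡ᵇ_; NonZero; >-nonZero)
open import Data.Nat.DivMod using (_%_; _/_; m≡m%n+[m/n]*n; m%n<n; m<n*o⇒m/o<n)
open import Data.Nat.ListAction using (sum)
open import Data.Nat.ListAction.Properties using (sum-++)
open import Data.Nat.Logarithm using (⌊log₂⌋-mono-≤; ⌊log₂[2^n]⌋≡n)
open import Data.Nat.Properties hiding (_≟_)
open import Algebra.Properties.CommutativeSemigroup +-commutativeSemigroup using () renaming (interchange to +-interchange)
open import Algebra.Properties.CommutativeSemigroup *-commutativeSemigroup
  using (x∙yz≈xz∙y; x∙yz≈y∙xz) renaming (interchange to *-interchange)
open import Data.Nat.Tactic.RingSolver using (solve-∀)
open import Data.Product using (∃; _,_; proj₁; proj₂)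
open import Data.Product.Properties using (≡-dec)
open import Data.List.Membership.DecPropositional (≡-dec Data.Nat._≟_ Data.Nat._≟_) using (_∈?_)
open import Data.Sum using (_⊎_; inj₁; inj₂)
open import Data.Vec using (Vec; []; _∷_; take; drop) renaming (_++_ to _++ᵛ_)
open import Function using (_∘_; Equivalence)
open import Relation.Binary.PropositionalEquality
  using (_≢_; refl; sym; trans; cong; cong₂; subst; subst₂; module ≡-Reasoning)
open import Relation.Nullary using (Dec; does; yes; no; contradiction)
open import Relation.Nullary.Decidable using (dec-true; dec-false)

private variable
  A B : Set
  n ℓ ℓ′ : ℕ

-- Indicators and finite sums

𝟙 : Bool → ℕ
𝟙 b = if b then 1 else 0

𝟙-∧ : ∀ a b → 𝟙 (a ∧ b) ≡ 𝟙 a * 𝟙 b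
𝟙-∧ true  b = sym (+-identityʳ (𝟙 b))
𝟙-∧ false b = refl

𝟙-mono : ∀ {a b} → (a ≡ true → b ≡ true) → 𝟙 a ≤ 𝟙 b
𝟙-mono {false} _   = z≤n
𝟙-mono {true}  a⇒b rewrite a⇒b refl = ≤-refl

𝟙≤ : ∀ {a c} → (a ≡ true → 1 ≤ c) → 𝟙 a ≤ c
𝟙≤ {false} _      = z≤n
𝟙≤ {true}  a⇒1≤c = a⇒1≤c refl

𝟙-cover : ∀ {a b c} → (b ≡ false → c ≡ false → a ≡ true) → 1 ≤ 𝟙 a + 𝟙 b + 𝟙 c
𝟙-cover {a} {true}  {c}     _ = ≤-trans (m≤n+m 1 (𝟙 a)) (m≤m+n _ (𝟙 c))
𝟙-cover {a} {false} {true}  _ = m≤n+m 1 _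
𝟙-cover {a} {false} {false} ¬b⇒¬c⇒a rewrite ¬b⇒¬c⇒a refl refl = s≤s z≤n

≡ᵇ0-false⇒pos : ∀ {x} → (x ≡ᵇ 0) ≡ false → 0 < x
≡ᵇ0-false⇒pos {suc x} _ = s≤s z≤n

<ᵇ-false⇒≤ : ∀ {m x} → (m <ᵇ x) ≡ false → x ≤ m
<ᵇ-false⇒≤ {m} {x} m≮x = ≮⇒≥ λ m<x → contradiction (trans (sym (Equivalence.to T-≡ (<⇒<ᵇ m<x))) m≮x) λ ()

∧-true⁻ : ∀ {a b} → a ∧ b ≡ true → a ≡ true × b ≡ true
∧-true⁻ ab = ∧-conicalˡ _ _ ab , ∧-conicalʳ _ _ ab

not-true⁻ : ∀ {a} → not a ≡ true → a ≡ false
not-true⁻ = not-injective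

does⇒ : ∀ {P : Set} (P? : Dec P) → does P? ≡ true → P
does⇒ (yes p) _ = p

∑ : List A → (A → ℕ) → ℕ
∑ xs f = sum (map f xs)

syntax ∑ xs (λ x → e) = ∑[ x ∈ xs ] e

∑-cong : ∀ (xs : List A) {f g : A → ℕ} → (∀ x → f x ≡ g x) → ∑ xs f ≡ ∑ xs g
∑-cong xs f≡g = cong sum (map-cong f≡g xs)

∑-mono-≤ : ∀ (xs : List A) {f g : A → ℕ} → (∀ x → f x ≤ g x) → ∑ xs f ≤ ∑ xs g
∑-mono-≤ []       f≤g = z≤n
∑-mono-≤ (x ∷ xs) f≤g = +-mono-≤ (f≤g x) (∑-mono-≤ xs f≤g)

∑-mono-< : ∀ {xs : List A} {f g : A → ℕ} {x} → (∀ x → f x ≤ g x) → x ∈ xs → f x < g x → ∑ xs f < ∑ xs g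
∑-mono-< {xs = _ ∷ xs} f≤g (here refl) fx<gx = +-mono-<-≤ fx<gx (∑-mono-≤ xs f≤g)
∑-mono-< {xs = y ∷ _}  f≤g (there x∈xs) fx<gx = +-mono-≤-< (f≤g y) (∑-mono-< f≤g x∈xs fx<gx)

∈⇒≤∑ : ∀ {xs : List A} (f : A → ℕ) {x} → x ∈ xs → f x ≤ ∑ xs f
∈⇒≤∑ f (here refl) = m≤m+n _ _
∈⇒≤∑ {xs = y ∷ _} f (there x∈xs) = ≤-trans (∈⇒≤∑ f x∈xs) (m≤n+m _ (f y))

∑𝟙-pos⇒∃ : ∀ (xs : List A) (p : A → Bool) → 0 < ∑[ x ∈ xs ] 𝟙 (p x) → ∃ λ x → p x ≡ true
∑𝟙-pos⇒∃ (x ∷ xs) p pos with p x in px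
... | true  = x , px
... | false = ∑𝟙-pos⇒∃ xs p pos

∑-const : ∀ (xs : List A) c → ∑[ _ ∈ xs ] c ≡ length xs * c
∑-const []       c = refl
∑-const (_ ∷ xs) c = cong (c +_) (∑-const xs c)

∑-0 : ∀ (xs : List A) → ∑[ _ ∈ xs ] 0 ≡ 0
∑-0 xs = trans (∑-const xs 0) (*-zeroʳ (length xs))

∑-++ : ∀ (xs ys : List A) (f : A → ℕ) → ∑ (xs ++ ys) f ≡ ∑ xs f + ∑ ys f
∑-++ xs ys f = trans (cong sum (map-++ f xs ys)) (sum-++ (map f xs) (map f ys))

∑-map : ∀ (g : A → B) (xs : List A) (f : B → ℕ) → ∑ (map g xs) f ≡ ∑ xs (f ∘ g)
∑-map g xs f = cong sum (sym (map-∘ xs))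

∑-distrib-+ : ∀ (xs : List A) (f g : A → ℕ) → ∑[ x ∈ xs ] (f x + g x) ≡ ∑ xs f + ∑ xs g
∑-distrib-+ []       f g = refl
∑-distrib-+ (x ∷ xs) f g = trans (cong (f x + g x +_) (∑-distrib-+ xs f g)) (+-interchange (f x) (g x) _ _)

*-distribˡ-∑ : ∀ c (xs : List A) (f : A → ℕ) → c * ∑ xs f ≡ ∑[ x ∈ xs ] (c * f x)
*-distribˡ-∑ c []       f = *-zeroʳ c
*-distribˡ-∑ c (x ∷ xs) f = trans (*-distribˡ-+ c (f x) _) (cong (c * f x +_) (*-distribˡ-∑ c xs f))

*-distribʳ-∑ : ∀ c (xs : List A) (f : A → ℕ) → ∑ xs f * c ≡ ∑[ x ∈ xs ] (f x * c)
*-distribʳ-∑ c xs f = trans (*-comm _ c) (trans (*-distribˡ-∑ c xs f) (∑-cong xs (λ x → *-comm c (f x))))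

∑-comm : ∀ (xs : List A) (ys : List B) (f : A → B → ℕ) →
         ∑[ x ∈ xs ] ∑[ y ∈ ys ] f x y ≡ ∑[ y ∈ ys ] ∑[ x ∈ xs ] f x y
∑-comm []       ys f = sym (∑-0 ys)
∑-comm (x ∷ xs) ys f = trans (cong (∑ ys (f x) +_) (∑-comm xs ys f)) (sym (∑-distrib-+ ys (f x) _))

∑-allFin-suc : ∀ (f : Fin (suc n) → ℕ) → ∑[ x ∈ allFin (suc n) ] f x ≡ f zero + ∑[ x ∈ allFin n ] f (suc x)
∑-allFin-suc f = cong (λ fs → f zero + sum fs) (trans (map-tabulate suc f) (sym (map-tabulate (λ x → x) (f ∘ suc))))

∑-*-∑ : ∀ (xs : List A) (ys : List B) (f : A → ℕ) (g : B → ℕ) →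
        ∑ xs f * ∑ ys g ≡ ∑[ x ∈ xs ] ∑[ y ∈ ys ] (f x * g y)
∑-*-∑ xs ys f g = trans (*-distribʳ-∑ (∑ ys g) xs f) (∑-cong xs (λ x → *-distribˡ-∑ (f x) ys g))

∑-cartesianProduct : ∀ (xs : List A) (ys : List B) (f : A × B → ℕ) →
                     ∑ (cartesianProduct xs ys) f ≡ ∑[ x ∈ xs ] ∑[ y ∈ ys ] f (x , y)
∑-cartesianProduct []       ys f = refl
∑-cartesianProduct (x ∷ xs) ys f = trans (∑-++ (map (x ,_) ys) _ f)
  (cong₂ _+_ (∑-map (x ,_) ys f) (∑-cartesianProduct xs ys f))

length-filterᵇ : ∀ (p : A → Bool) xs → length (filterᵇ p xs) ≡ ∑[ x ∈ xs ] 𝟙 (p x)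
length-filterᵇ p []       = refl
length-filterᵇ p (x ∷ xs) with p x
... | true  = cong suc (length-filterᵇ p xs)
... | false = length-filterᵇ p xs

findᵇ-sound : ∀ (p : A → Bool) xs {a} → findᵇ p xs ≡ just a → p a ≡ true
findᵇ-sound p (x ∷ xs) found with p x in px
... | true  with refl ← found = px
... | false = findᵇ-sound p xs found

findᵇ-complete : ∀ (p : A → Bool) {xs a} → a ∈ xs → p a ≡ true → ∃ λ a′ → findᵇ p xs ≡ just a′
findᵇ-complete p {x ∷ xs} a∈xs pa with p x in px | a∈xs
... | true  | _            = x , refl
... | false | here refl    = contradiction (trans (sym px) pa) λ ()
... | false | there a∈xs′  = findᵇ-complete p a∈xs′ pa

2ab≤a²+b² : ∀ a b → 2 * a * b ≤ a * a + b * b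
2ab≤a²+b² a b with ≤-total a b
... | inj₁ a≤b with d , refl ← m≤n⇒∃[o]m+o≡n a≤b = ≤-trans (m≤m+n _ (d * d)) (≤-reflexive (square a d))
  where
  square : ∀ a d → 2 * a * (a + d) + d * d ≡ a * a + (a + d) * (a + d)
  square = solve-∀
... | inj₂ b≤a with d , refl ← m≤n⇒∃[o]m+o≡n b≤a = ≤-trans (m≤m+n _ (d * d)) (≤-reflexive (square b d))
  where
  square : ∀ b d → 2 * (b + d) * b + d * d ≡ (b + d) * (b + d) + b * b
  square = solve-∀

markov : ∀ (xs : List A) (f : A → ℕ) M → ∑[ x ∈ xs ] 𝟙 (M <ᵇ f x) * suc M ≤ ∑ xs f
markov xs f M = ≤-trans (≤-reflexive (*-distribʳ-∑ (suc M) xs _)) (∑-mono-≤ xs pointwise)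
  where
  pointwise : ∀ x → 𝟙 (M <ᵇ f x) * suc M ≤ f x
  pointwise x with M <ᵇ f x in M<fx
  ... | false = z≤n
  ... | true  = ≤-trans (≤-reflexive (+-identityʳ _)) (<ᵇ⇒< M (f x) (Equivalence.from T-≡ M<fx))

-- The second moment method: if X has mean τ / c and second moment at most τ (τ + K) / c²,
-- then X vanishes with probability at most K / τ.
second-moment : ∀ (xs : List A) (X : A → ℕ) {c τ K} → 0 < τ →
                c * ∑ xs X ≡ τ * length xs →
                c * c * ∑[ x ∈ xs ] (X x * X x) ≤ length xs * (τ * (τ + K)) →
                ∑[ x ∈ xs ] 𝟙 (X x ≡ᵇ 0) * τ ≤ length xs * K
second-moment xs X {c} {τ} {K} 0<τ ∑X ∑X² = *-cancelʳ-≤ _ _ τ {{>-nonZero 0<τ}} (+-cancelʳ-≤ (2 * τ * (τ * N)) _ _ (begin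
  Z * τ * τ + 2 * τ * (τ * N)                            ≡⟨ cong₂ _+_ (*-assoc Z τ τ) (cong (2 * τ *_) (sym ∑X)) ⟩
  Z * (τ * τ) + 2 * τ * (c * ∑ xs X)                     ≡⟨ summed-lhs ⟨
  ∑[ x ∈ xs ] (𝟙 (X x ≡ᵇ 0) * (τ * τ) + 2 * τ * (c * X x)) ≤⟨ ∑-mono-≤ xs (λ x → pointwise (X x)) ⟩
  ∑[ x ∈ xs ] (c * c * (X x * X x) + τ * τ)               ≡⟨ summed-rhs ⟩
  c * c * ∑[ x ∈ xs ] (X x * X x) + τ * τ * N             ≤⟨ +-monoˡ-≤ (τ * τ * N) ∑X² ⟩
  N * (τ * (τ + K)) + τ * τ * N                          ≡⟨ rearrange N τ K ⟩
  N * K * τ + 2 * τ * (τ * N)                            ∎))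
  where
  open ≤-Reasoning
  N = length xs
  Z = ∑[ x ∈ xs ] 𝟙 (X x ≡ᵇ 0)
  pointwise : ∀ x → 𝟙 (x ≡ᵇ 0) * (τ * τ) + 2 * τ * (c * x) ≤ c * c * (x * x) + τ * τ
  pointwise zero    = ≤-reflexive (at-zero τ c)
    where
    at-zero : ∀ τ c → 1 * (τ * τ) + 2 * τ * (c * 0) ≡ c * c * (0 * 0) + τ * τ
    at-zero = solve-∀
  pointwise (suc x) = ≤-trans (2ab≤a²+b² τ (c * suc x)) (≤-reflexive (at-suc τ c (suc x)))
    where
    at-suc : ∀ τ c y → τ * τ + c * y * (c * y) ≡ c * c * (y * y) + τ * τ
    at-suc = solve-∀
  summed-lhs : ∑[ x ∈ xs ] (𝟙 (X x ≡ᵇ 0) * (τ * τ) + 2 * τ * (c * X x)) ≡ Z * (τ * τ) + 2 * τ * (c * ∑ xs X)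
  summed-lhs = trans (∑-distrib-+ xs _ _) (cong₂ _+_ (sym (*-distribʳ-∑ (τ * τ) xs _))
                 (sym (trans (cong (2 * τ *_) (*-distribˡ-∑ c xs X)) (*-distribˡ-∑ (2 * τ) xs _))))
  summed-rhs : ∑[ x ∈ xs ] (c * c * (X x * X x) + τ * τ) ≡ c * c * ∑[ x ∈ xs ] (X x * X x) + τ * τ * N
  summed-rhs = trans (∑-distrib-+ xs _ _) (cong₂ _+_ (sym (*-distribˡ-∑ (c * c) xs _)) (trans (∑-const xs (τ * τ)) (*-comm N (τ * τ))))
  rearrange : ∀ N τ K → N * (τ * (τ + K)) + τ * τ * N ≡ N * K * τ + 2 * τ * (τ * N)
  rearrange = solve-∀

-- Sets of vertices

VSet : ℕ → Set
VSet n = Fin n → Bool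

_∪_ : VSet n → VSet n → VSet n
(U ∪ V) x = U x ∨ V x

_∩_ : VSet n → VSet n → VSet n
(U ∩ V) x = U x ∧ V x

_∖_ : VSet n → VSet n → VSet n
(U ∖ V) x = U x ∧ not (V x)

_⊆_ : VSet n → VSet n → Set
U ⊆ V = ∀ x → U x ≡ true → V x ≡ true

⁅_⁆ : Fin n → VSet n
⁅ v ⁆ x = does (x ≟ v)

⁅⁆-refl : ∀ (x : Fin n) → ⁅ x ⁆ x ≡ true
⁅⁆-refl x = dec-true (x ≟ x) refl

⁅⁆⇒≡ : ∀ {x v : Fin n} → ⁅ v ⁆ x ≡ true → x ≡ v
⁅⁆⇒≡ {x = x} {v} = does⇒ (x ≟ v)

pairSet : Fin n → Fin n → VSet n
pairSet u v = ⁅ u ⁆ ∪ ⁅ v ⁆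

tripleSet : Fin n → Fin n → Fin n → VSet n
tripleSet a b c = ⁅ a ⁆ ∪ pairSet b c

card : VSet n → ℕ
card {n} U = ∑[ x ∈ allFin n ] 𝟙 (U x)

card-∅ : ∀ {U : VSet n} → (∀ x → U x ≡ false) → card U ≡ 0
card-∅ {n} U≡∅ = trans (∑-cong (allFin n) (cong 𝟙 ∘ U≡∅)) (∑-0 (allFin n))

card-⁅⁆ : ∀ (v : Fin n) → card ⁅ v ⁆ ≡ 1
card-⁅⁆ {suc n} v@zero    = trans (∑-allFin-suc (𝟙 ∘ ⁅ v ⁆)) (cong suc (card-∅ {n} (λ _ → refl)))
card-⁅⁆ {suc n} v@(suc w) = trans (∑-allFin-suc (𝟙 ∘ ⁅ v ⁆)) (card-⁅⁆ w)

card-mono : ∀ {U V : VSet n} → U ⊆ V → card U ≤ card V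
card-mono {n} U⊆V = ∑-mono-≤ (allFin n) (λ x → 𝟙-mono (U⊆V x))

card-pos⇒∃ : ∀ (U : VSet n) → 0 < card U → ∃ λ x → U x ≡ true
card-pos⇒∃ {n} U = ∑𝟙-pos⇒∃ (allFin n) U

card-∪-∩ : ∀ (U V : VSet n) → card (U ∪ V) + card (U ∩ V) ≡ card U + card V
card-∪-∩ {n} U V = begin
  card (U ∪ V) + card (U ∩ V)               ≡⟨ ∑-distrib-+ (allFin n) _ _ ⟨
  ∑[ x ∈ allFin n ] (𝟙 (U x ∨ V x) + 𝟙 (U x ∧ V x)) ≡⟨ ∑-cong (allFin n) (λ x → 𝟙-∨-∧ (U x) (V x)) ⟩
  ∑[ x ∈ allFin n ] (𝟙 (U x) + 𝟙 (V x))   ≡⟨ ∑-distrib-+ (allFin n) _ _ ⟩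
  card U + card V                           ∎
  where
  open ≡-Reasoning
  𝟙-∨-∧ : ∀ a b → 𝟙 (a ∨ b) + 𝟙 (a ∧ b) ≡ 𝟙 a + 𝟙 b
  𝟙-∨-∧ true  true  = refl
  𝟙-∨-∧ true  false = refl
  𝟙-∨-∧ false b     = +-identityʳ (𝟙 b)

card-∪-≤ : ∀ (U V : VSet n) → card (U ∪ V) ≤ card U + card V
card-∪-≤ U V = ≤-trans (m≤m+n _ _) (≤-reflexive (card-∪-∩ U V))

card-∪-disjoint : ∀ (U V : VSet n) → (∀ x → (U ∩ V) x ≡ false) → card (U ∪ V) ≡ card U + card V
card-∪-disjoint U V disjoint =
  trans (sym (+-identityʳ _)) (trans (cong (card (U ∪ V) +_) (sym (card-∅ disjoint))) (card-∪-∩ U V))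

⁅⁆-disjoint : ∀ {u v : Fin n} → u ≢ v → ∀ x → (⁅ u ⁆ ∩ ⁅ v ⁆) x ≡ false
⁅⁆-disjoint {u = u} {v} u≢v x with x ≟ u
... | yes refl = dec-false (u ≟ v) u≢v
... | no  _    = refl

card-pairSet : ∀ {u v : Fin n} → u ≢ v → card (pairSet u v) ≡ 2
card-pairSet {u = u} {v} u≢v =
  trans (card-∪-disjoint ⁅ u ⁆ ⁅ v ⁆ (⁅⁆-disjoint u≢v)) (cong₂ _+_ (card-⁅⁆ u) (card-⁅⁆ v))

card-tripleSet : ∀ {a b c : Fin n} → a ≢ b → a ≢ c → b ≢ c → card (tripleSet a b c) ≡ 3
card-tripleSet {a = a} {b} {c} a≢b a≢c b≢c =
  trans (card-∪-disjoint ⁅ a ⁆ (pairSet b c) disjoint) (cong₂ _+_ (card-⁅⁆ a) (card-pairSet b≢c))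
  where
  disjoint : ∀ x → (⁅ a ⁆ ∩ pairSet b c) x ≡ false
  disjoint x with x ≟ a
  ... | yes refl = cong₂ _∨_ (dec-false (a ≟ b) a≢b) (dec-false (a ≟ c) a≢c)
  ... | no  _    = refl

card≥2⇒∃≢ : ∀ (U : VSet n) → 2 ≤ card U → ∃ λ x → ∃ λ y → x ≢ y × U x ≡ true × U y ≡ true
card≥2⇒∃≢ U 2≤|U| with card-pos⇒∃ U (≤-trans (s≤s z≤n) 2≤|U|)
... | x , Ux with card-pos⇒∃ (U ∖ ⁅ x ⁆) 0<|U∖x|
  where
  U⊆U∖x∪x : U ⊆ ((U ∖ ⁅ x ⁆) ∪ ⁅ x ⁆)
  U⊆U∖x∪x y Uy with y ≟ x
  ... | yes _ = ∨-zeroʳ _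
  ... | no  _ = cong (_∨ false) (cong₂ _∧_ Uy refl)
  0<|U∖x| : 0 < card (U ∖ ⁅ x ⁆)
  0<|U∖x| = +-cancelʳ-≤ 1 1 _ (begin
    2                              ≤⟨ 2≤|U| ⟩
    card U                         ≤⟨ card-mono U⊆U∖x∪x ⟩
    card ((U ∖ ⁅ x ⁆) ∪ ⁅ x ⁆)     ≤⟨ card-∪-≤ (U ∖ ⁅ x ⁆) ⁅ x ⁆ ⟩
    card (U ∖ ⁅ x ⁆) + card ⁅ x ⁆  ≡⟨ cong (card (U ∖ ⁅ x ⁆) +_) (card-⁅⁆ x) ⟩
    card (U ∖ ⁅ x ⁆) + 1           ∎)
    where open ≤-Reasoning
... | y , Uy∧y≢x = x , y , x≢y , Ux , ∧-conicalˡ _ _ Uy∧y≢x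
  where
  x≢y : x ≢ y
  x≢y refl = contradiction (trans (sym (not-true⁻ (∧-conicalʳ _ _ Uy∧y≢x))) (⁅⁆-refl x)) λ ()

≟-sym : ∀ (x y : Fin n) → does (x ≟ y) ≡ does (y ≟ x)
≟-sym x y with x ≟ y | y ≟ x
... | yes _   | yes _   = refl
... | no  _   | no  _   = refl
... | yes x≡y | no  y≢x = contradiction (sym x≡y) y≢x
... | no  x≢y | yes y≡x = contradiction (sym y≡x) x≢y

clique : VSet n → Graph n
clique U x y = U x ∧ U y ∧ not (does (x ≟ y))

clique-sym : ∀ (U : VSet n) → Symmetric (clique U)
clique-sym U x y with U x | U y
... | true  | true  = cong not (≟-sym x y)
... | true  | false = refl
... | false | true  = refl
... | false | false = refl

pairCount-clique : ∀ (U : VSet n) → pairCount (clique U) ≤ card U * card U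
pairCount-clique {n} U = begin
  pairCount (clique U)
    ≤⟨ ∑-mono-≤ (allFin n) (λ x → ∑-mono-≤ (allFin n) (λ y → 𝟙-clique (U x) (U y) _)) ⟩
  ∑[ x ∈ allFin n ] ∑[ y ∈ allFin n ] (𝟙 (U x) * 𝟙 (U y))
    ≡⟨ ∑-*-∑ (allFin n) (allFin n) (𝟙 ∘ U) (𝟙 ∘ U) ⟨
  card U * card U ∎
  where
  open ≤-Reasoning
  𝟙-clique : ∀ a b c → 𝟙 (a ∧ b ∧ c) ≤ 𝟙 a * 𝟙 b
  𝟙-clique true  true  c = 𝟙-mono (λ _ → refl)
  𝟙-clique true  false c = z≤n
  𝟙-clique false b     c = z≤n

tripleSet-cases : ∀ {a b c x : Fin n} → tripleSet a b c x ≡ true → x ≡ a ⊎ x ≡ b ⊎ x ≡ c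
tripleSet-cases {a = a} {b} {c} {x} x∈abc with ⁅ a ⁆ x in x∈a | ⁅ b ⁆ x in x∈b
... | true  | _    = inj₁ (⁅⁆⇒≡ x∈a)
... | false | true = inj₂ (inj₁ (⁅⁆⇒≡ x∈b))
... | false | false = inj₂ (inj₂ (⁅⁆⇒≡ x∈abc))

∈tripleSet₁ : ∀ (a b c : Fin n) → tripleSet a b c a ≡ true
∈tripleSet₁ a b c = cong (_∨ pairSet b c a) (⁅⁆-refl a)

∈tripleSet₂ : ∀ (a b c : Fin n) → tripleSet a b c b ≡ true
∈tripleSet₂ a b c = trans (cong (λ z → ⁅ a ⁆ b ∨ z ∨ ⁅ c ⁆ b) (⁅⁆-refl b)) (∨-zeroʳ _)

∈tripleSet₃ : ∀ (a b c : Fin n) → tripleSet a b c c ≡ true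
∈tripleSet₃ a b c =
  trans (cong (λ z → ⁅ a ⁆ c ∨ ⁅ b ⁆ c ∨ z) (⁅⁆-refl c)) (trans (cong (⁅ a ⁆ c ∨_) (∨-zeroʳ _)) (∨-zeroʳ _))

clique⁻ : ∀ (U : VSet n) {x y} → clique U x y ≡ true → U x ≡ true × U y ≡ true × x ≢ y
clique⁻ U {x} {y} xy∈U with Ux , Uy∧x≢y ← ∧-true⁻ {U x} xy∈U with Uy , x≢y ← ∧-true⁻ {U y} Uy∧x≢y =
  Ux , Uy , λ { refl → contradiction (trans (sym (not-true⁻ x≢y)) (⁅⁆-refl x)) λ () }

clique⁺ : ∀ (U : VSet n) x y → U x ≡ true → U y ≡ true → x ≢ y → clique U x y ≡ true
clique⁺ U x y Ux Uy x≢y = cong₂ _∧_ Ux (cong₂ _∧_ Uy (cong not (dec-false (x ≟ y) x≢y)))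

clique-tripleSet-elim : ∀ (Q : Fin n → Fin n → Set) → (∀ {x y} → Q x y → Q y x) →
                        ∀ {a b c} → Q a b → Q b c → Q a c →
                        ∀ x y → clique (tripleSet a b c) x y ≡ true → Q x y
clique-tripleSet-elim Q Q-sym {a} {b} {c} Qab Qbc Qac x y xy∈abc
  with x∈abc , y∈abc , x≢y ← clique⁻ (tripleSet a b c) {x} {y} xy∈abc
  with tripleSet-cases {a = a} {b} {c} {x} x∈abc | tripleSet-cases {a = a} {b} {c} {y} y∈abc
... | inj₁ refl        | inj₂ (inj₁ refl) = Qab
... | inj₁ refl        | inj₂ (inj₂ refl) = Qac
... | inj₂ (inj₁ refl) | inj₂ (inj₂ refl) = Qbc
... | inj₂ (inj₁ refl) | inj₁ refl        = Q-sym Qab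
... | inj₂ (inj₂ refl) | inj₁ refl        = Q-sym Qac
... | inj₂ (inj₂ refl) | inj₂ (inj₁ refl) = Q-sym Qbc
... | inj₁ refl        | inj₁ refl        = contradiction refl x≢y
... | inj₂ (inj₁ refl) | inj₂ (inj₁ refl) = contradiction refl x≢y
... | inj₂ (inj₂ refl) | inj₂ (inj₂ refl) = contradiction refl x≢y

-- Graphs

pairCount-mono : ∀ {G H : Graph n} → G ⊆ᴳ H → pairCount G ≤ pairCount H
pairCount-mono {n} G⊆H = ∑-mono-≤ (allFin n) (λ x → ∑-mono-≤ (allFin n) (λ y → 𝟙-mono (G⊆H x y)))

pairCount-mono-< : ∀ {G H : Graph n} {u v} → G ⊆ᴳ H → G u v ≡ false → H u v ≡ true → pairCount G < pairCount H
pairCount-mono-< {n} {G} {H} {u} {v} G⊆H ¬Guv Huv =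
  ∑-mono-< (λ x → ∑-mono-≤ (allFin n) (λ y → 𝟙-mono (G⊆H x y))) (∈-allFin u)
    (∑-mono-< (λ y → 𝟙-mono (G⊆H u y)) (∈-allFin v) (subst₂ (λ g h → 𝟙 g < 𝟙 h) (sym ¬Guv) (sym Huv) ≤-refl))

isTriangle⁻ : ∀ (G : Graph n) {u v w} → isTriangle G u v w ≡ true → G u v ≡ true × G v w ≡ true × G u w ≡ true
isTriangle⁻ G {u} {v} {w} uvw with Guv , Gvw∧Guw ← ∧-true⁻ {G u v} uvw with Gvw , Guw ← ∧-true⁻ {G v w} Gvw∧Guw =
  Guv , Gvw , Guw

isTriangle-mono : ∀ {G H : Graph n} {u v w} → G ⊆ᴳ H → isTriangle G u v w ≡ true → isTriangle H u v w ≡ true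
isTriangle-mono {G = G} {H} {u} {v} {w} G⊆H uvw with Guv , Gvw , Guw ← isTriangle⁻ G uvw =
  cong₂ _∧_ (G⊆H u v Guv) (cong₂ _∧_ (G⊆H v w Gvw) (G⊆H u w Guw))

removeEdges-triangle : ∀ {A R : Graph n} {u v w} → isTriangle (removeEdges A R) u v w ≡ true →
                       isTriangle A u v w ≡ true × R u v ≡ false × R v w ≡ false × R u w ≡ false
removeEdges-triangle {A = A} {R} {u} {v} {w} uvw
  with uv , vw∧uw ← ∧-true⁻ {A u v ∧ not (R u v)} uvw
  with vw , uw ← ∧-true⁻ {A v w ∧ not (R v w)} vw∧uw
  with Auv , ¬Ruv ← ∧-true⁻ {A u v} uv
  with Avw , ¬Rvw ← ∧-true⁻ {A v w} vw
  with Auw , ¬Ruw ← ∧-true⁻ {A u w} uw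
  = cong₂ _∧_ Auv (cong₂ _∧_ Avw Auw) , not-true⁻ ¬Ruv , not-true⁻ ¬Rvw , not-true⁻ ¬Ruw

-- Sampling vertices with shared randomness

allTrue : Vec Bool ℓ → Bool
allTrue []       = true
allTrue (x ∷ xs) = x ∧ allTrue xs

-- ρ is read as n blocks of b bits; a vertex is sampled iff its block is all true,
-- so that vertices are sampled independently with probability 2⁻ᵇ.
inSample : ∀ b → VSet n → Vec Bool (n * b) → Bool
inSample {zero}  b U ρ = true
inSample {suc n} b U ρ = (not (U zero) ∨ allTrue (take b ρ)) ∧ inSample b (U ∘ suc) (drop b ρ)

take-++ᵛ : ∀ (x : Vec A ℓ) (y : Vec A ℓ′) → take ℓ (x ++ᵛ y) ≡ x
take-++ᵛ []      y = refl
take-++ᵛ (a ∷ x) y = cong (a ∷_) (take-++ᵛ x y)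

drop-++ᵛ : ∀ (x : Vec A ℓ) (y : Vec A ℓ′) → drop ℓ (x ++ᵛ y) ≡ y
drop-++ᵛ []      y = refl
drop-++ᵛ (a ∷ x) y = drop-++ᵛ x y

length-allVecs : ∀ r → length (allVecs r) ≡ 2 ^ r
length-allVecs zero    = refl
length-allVecs (suc r) = begin
  length (map (true ∷_) (allVecs r) ++ map (false ∷_) (allVecs r))  ≡⟨ length-++ (map (true ∷_) (allVecs r)) ⟩
  length (map (true ∷_) (allVecs r)) + length (map (false ∷_) (allVecs r))
    ≡⟨ cong₂ _+_ (trans (length-map _ (allVecs r)) (length-allVecs r)) (trans (length-map _ (allVecs r)) (length-allVecs r)) ⟩
  2 ^ r + 2 ^ r                                                     ≡⟨ cong (2 ^ r +_) (+-identityʳ (2 ^ r)) ⟨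
  2 ^ suc r                                                         ∎
  where open ≡-Reasoning

∑-allVecs-suc : ∀ (f : Vec Bool (suc ℓ) → ℕ) →
                ∑[ ρ ∈ allVecs (suc ℓ) ] f ρ ≡ ∑[ ρ ∈ allVecs ℓ ] f (true ∷ ρ) + ∑[ ρ ∈ allVecs ℓ ] f (false ∷ ρ)
∑-allVecs-suc {ℓ} f = trans (∑-++ (map (true ∷_) (allVecs ℓ)) _ f)
                            (cong₂ _+_ (∑-map (true ∷_) (allVecs ℓ) f) (∑-map (false ∷_) (allVecs ℓ) f))

∑-allVecs-++ : ∀ b r (f : Vec Bool (b + r) → ℕ) →
               ∑[ ρ ∈ allVecs (b + r) ] f ρ ≡ ∑[ x ∈ allVecs b ] ∑[ y ∈ allVecs r ] f (x ++ᵛ y)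
∑-allVecs-++ zero    r f = sym (+-identityʳ _)
∑-allVecs-++ (suc b) r f = trans (∑-allVecs-suc f) (trans
  (cong₂ _+_ (∑-allVecs-++ b r (f ∘ (true ∷_))) (∑-allVecs-++ b r (f ∘ (false ∷_))))
  (sym (∑-allVecs-suc {b} (λ x → ∑[ y ∈ allVecs r ] f (x ++ᵛ y)))))

∑-allVecs-allTrue : ∀ b → ∑[ x ∈ allVecs b ] 𝟙 (allTrue x) ≡ 1
∑-allVecs-allTrue zero    = refl
∑-allVecs-allTrue (suc b) = trans (∑-allVecs-suc {b} (𝟙 ∘ allTrue)) (cong₂ _+_ (∑-allVecs-allTrue b) (∑-0 (allVecs b)))

inSampleCount : ∀ b → VSet n → ℕ
inSampleCount {n} b U = ∑[ ρ ∈ allVecs (n * b) ] 𝟙 (inSample b U ρ)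

inSampleCount-≡ : ∀ b (U : VSet n) → (2 ^ b) ^ card U * inSampleCount b U ≡ 2 ^ (n * b)
inSampleCount-≡ {zero}  b U = refl
inSampleCount-≡ {suc n} b U = begin
  m ^ card U * ∑[ ρ ∈ allVecs (b + n * b) ] 𝟙 (inSample b U ρ)
    ≡⟨ cong₂ _*_ (cong (m ^_) (∑-allFin-suc (𝟙 ∘ U))) (∑-allVecs-++ b (n * b) _) ⟩
  m ^ (𝟙 u + card U′) * ∑[ x ∈ allVecs b ] ∑[ y ∈ allVecs (n * b) ] 𝟙 (inSample b U (x ++ᵛ y))
    ≡⟨ cong₂ _*_ (^-distribˡ-+-* m (𝟙 u) (card U′))
                 (trans (∑-cong (allVecs b) (λ x → ∑-cong (allVecs (n * b)) (split x)))
                        (sym (∑-*-∑ (allVecs b) (allVecs (n * b)) (λ x → 𝟙 (not u ∨ allTrue x)) (𝟙 ∘ inSample b U′)))) ⟩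
  m ^ 𝟙 u * m ^ card U′ * (∑[ x ∈ allVecs b ] 𝟙 (not u ∨ allTrue x) * ∑[ y ∈ allVecs (n * b) ] 𝟙 (inSample b U′ y))
    ≡⟨ *-interchange (m ^ 𝟙 u) _ _ _ ⟩
  m ^ 𝟙 u * ∑[ x ∈ allVecs b ] 𝟙 (not u ∨ allTrue x) * (m ^ card U′ * ∑[ y ∈ allVecs (n * b) ] 𝟙 (inSample b U′ y))
    ≡⟨ cong₂ _*_ (first-block u) (inSampleCount-≡ b U′) ⟩
  m * 2 ^ (n * b)
    ≡⟨ ^-distribˡ-+-* 2 b (n * b) ⟨
  2 ^ (b + n * b) ∎
  where
  open ≡-Reasoning
  m = 2 ^ b
  u = U zero
  U′ = U ∘ suc
  split : ∀ x y → 𝟙 (inSample b U (x ++ᵛ y)) ≡ 𝟙 (not u ∨ allTrue x) * 𝟙 (inSample b U′ y)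
  split x y = trans (cong 𝟙 (cong₂ (λ x′ y′ → (not u ∨ allTrue x′) ∧ inSample b U′ y′) (take-++ᵛ x y) (drop-++ᵛ x y)))
                    (𝟙-∧ (not u ∨ allTrue x) (inSample b U′ y))
  first-block : ∀ u → m ^ 𝟙 u * ∑[ x ∈ allVecs b ] 𝟙 (not u ∨ allTrue x) ≡ m
  first-block true  = trans (cong (m ^ 1 *_) (∑-allVecs-allTrue b)) (trans (*-identityʳ _) (*-identityʳ m))
  first-block false = trans (+-identityʳ _) (trans (∑-const (allVecs b) 1) (trans (*-identityʳ _) (length-allVecs b)))

inSample-∪ : ∀ b (U V : VSet n) ρ → inSample b (U ∪ V) ρ ≡ inSample b U ρ ∧ inSample b V ρ
inSample-∪ {zero}  b U V ρ = refl
inSample-∪ {suc n} b U V ρ =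
  trans (cong ((not (U zero ∨ V zero) ∨ allTrue (take b ρ)) ∧_) (inSample-∪ b (U ∘ suc) (V ∘ suc) (drop b ρ)))
        (step (U zero) (V zero) (allTrue (take b ρ)) (inSample b (U ∘ suc) (drop b ρ)) (inSample b (V ∘ suc) (drop b ρ)))
  where
  step : ∀ u v s r₁ r₂ → (not (u ∨ v) ∨ s) ∧ (r₁ ∧ r₂) ≡ ((not u ∨ s) ∧ r₁) ∧ ((not v ∨ s) ∧ r₂)
  step false false s     r₁    r₂ = refl
  step true  true  true  r₁    r₂ = refl
  step true  false true  r₁    r₂ = refl
  step false true  true  r₁    r₂ = refl
  step true  v     false r₁    r₂ = refl
  step false true  false true  r₂ = refl
  step false true  false false r₂ = refl

induced : ∀ b → Graph n → Vec Bool (n * b) → Graph n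
induced b G ρ u v = G u v ∧ inSample b (pairSet u v) ρ

induced⊆ : ∀ b {G H : Graph n} ρ → G ⊆ᴳ H → induced b G ρ ⊆ᴳ induced b H ρ
induced⊆ b ρ G⊆H u v uv∈G = cong₂ _∧_ (G⊆H u v (∧-conicalˡ _ _ uv∈G)) (∧-conicalʳ _ _ uv∈G)

∑pairCount-induced : ∀ b (G : Graph n) → (∀ u → G u u ≡ false) →
                     2 ^ b * 2 ^ b * ∑[ ρ ∈ allVecs (n * b) ] pairCount (induced b G ρ) ≡ pairCount G * 2 ^ (n * b)
∑pairCount-induced {n} b G loopless = begin
  m² * ∑[ ρ ∈ Ω ] ∑[ u ∈ allFin n ] ∑[ v ∈ allFin n ] 𝟙 (induced b G ρ u v)
    ≡⟨ cong (m² *_) (trans (∑-comm Ω (allFin n) _) (∑-cong (allFin n) (λ u → ∑-comm Ω (allFin n) _))) ⟩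
  m² * ∑[ u ∈ allFin n ] ∑[ v ∈ allFin n ] ∑[ ρ ∈ Ω ] 𝟙 (induced b G ρ u v)
    ≡⟨ trans (*-distribˡ-∑ m² (allFin n) _) (∑-cong (allFin n) (λ u → *-distribˡ-∑ m² (allFin n) _)) ⟩
  ∑[ u ∈ allFin n ] ∑[ v ∈ allFin n ] (m² * ∑[ ρ ∈ Ω ] 𝟙 (induced b G ρ u v))
    ≡⟨ ∑-cong (allFin n) (λ u → ∑-cong (allFin n) (pair-term u)) ⟩
  ∑[ u ∈ allFin n ] ∑[ v ∈ allFin n ] (𝟙 (G u v) * 2 ^ (n * b))
    ≡⟨ trans (∑-cong (allFin n) (λ u → sym (*-distribʳ-∑ (2 ^ (n * b)) (allFin n) _)))
             (sym (*-distribʳ-∑ (2 ^ (n * b)) (allFin n) _)) ⟩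
  pairCount G * 2 ^ (n * b) ∎
  where
  open ≡-Reasoning
  m² = 2 ^ b * 2 ^ b
  Ω = allVecs (n * b)
  pair-term : ∀ u v → m² * ∑[ ρ ∈ Ω ] 𝟙 (induced b G ρ u v) ≡ 𝟙 (G u v) * 2 ^ (n * b)
  pair-term u v with G u v in uv∈G
  ... | false = trans (cong (m² *_) (∑-0 Ω)) (*-zeroʳ m²)
  ... | true  = trans (cong (λ c → 2 ^ b * c * inSampleCount b (pairSet u v)) (sym (*-identityʳ (2 ^ b))))
                 (trans (cong (λ c → (2 ^ b) ^ c * inSampleCount b (pairSet u v)) (sym (card-pairSet u≢v)))
                      (trans (inSampleCount-≡ b (pairSet u v)) (sym (+-identityʳ _))))
    where
    u≢v : u ≢ v
    u≢v refl = contradiction (trans (sym uv∈G) (loopless u)) λ ()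

overflow-bound : ∀ b (G : Graph n) → (∀ u → G u u ≡ false) → ∀ M →
                 ∑[ ρ ∈ allVecs (n * b) ] 𝟙 (M <ᵇ pairCount (induced b G ρ)) * suc M * (2 ^ b * 2 ^ b) ≤ pairCount G * 2 ^ (n * b)
overflow-bound {n} b G loopless M = begin
  Y * suc M * (2 ^ b * 2 ^ b)                                         ≤⟨ *-monoˡ-≤ (2 ^ b * 2 ^ b) (markov (allVecs (n * b)) _ M) ⟩
  ∑[ ρ ∈ allVecs (n * b) ] pairCount (induced b G ρ) * (2 ^ b * 2 ^ b) ≡⟨ *-comm _ (2 ^ b * 2 ^ b) ⟩
  2 ^ b * 2 ^ b * ∑[ ρ ∈ allVecs (n * b) ] pairCount (induced b G ρ)  ≡⟨ ∑pairCount-induced b G loopless ⟩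
  pairCount G * 2 ^ (n * b)                                            ∎
  where
  open ≤-Reasoning
  Y = ∑[ ρ ∈ allVecs (n * b) ] 𝟙 (M <ᵇ pairCount (induced b G ρ))

-- Edge-disjoint triangle packings

record Triangle (A : Graph n) : Set where
  constructor triangle
  field
    {u v w} : Fin n
    isTri   : isTriangle A u v w ≡ true

  vertices : VSet n
  vertices = tripleSet u v w

  edges : Graph n
  edges = clique vertices

open Triangle using (vertices; edges)

module _ {A : Graph n} (simple : IsSimple A) where

  adjacent⇒≢ : ∀ {x y} → A x y ≡ true → x ≢ y
  adjacent⇒≢ {x} Axy refl = contradiction (trans (sym Axy) (proj₂ simple x)) λ ()

  card-vertices : ∀ (t : Triangle A) → card (vertices t) ≡ 3
  card-vertices (triangle uvw) with Auv , Avw , Auw ← isTriangle⁻ A uvw =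
    card-tripleSet (adjacent⇒≢ Auv) (adjacent⇒≢ Auw) (adjacent⇒≢ Avw)

  edges⊆A : ∀ (t : Triangle A) → edges t ⊆ᴳ A
  edges⊆A (triangle uvw) with Auv , Avw , Auw ← isTriangle⁻ A uvw =
    clique-tripleSet-elim (λ x y → A x y ≡ true) (λ {x} {y} Axy → trans (proj₁ simple y x) Axy) Auv Avw Auw

  edge-uv : ∀ (t : Triangle A) → edges t (Triangle.u t) (Triangle.v t) ≡ true
  edge-uv t@(triangle {u} {v} {w} uvw) =
    clique⁺ (vertices t) u v (∈tripleSet₁ u v w) (∈tripleSet₂ u v w) (adjacent⇒≢ (proj₁ (isTriangle⁻ A uvw)))

  vertex⇒edge : ∀ (t : Triangle A) {x} → vertices t x ≡ true → ∃ λ y → edges t x y ≡ true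
  vertex⇒edge t@(triangle {u} {v} {w} uvw) {x} x∈t with Auv , Avw , Auw ← isTriangle⁻ A uvw with tripleSet-cases {x = x} x∈t
  ... | inj₁ refl        = v , clique⁺ (vertices t) u v (∈tripleSet₁ u v w) (∈tripleSet₂ u v w) (adjacent⇒≢ Auv)
  ... | inj₂ (inj₁ refl) = w , clique⁺ (vertices t) v w (∈tripleSet₂ u v w) (∈tripleSet₃ u v w) (adjacent⇒≢ Avw)
  ... | inj₂ (inj₂ refl) = u , clique⁺ (vertices t) w u (∈tripleSet₃ u v w) (∈tripleSet₁ u v w) (adjacent⇒≢ Auw ∘ sym)

module _ {A : Graph n} where

  multiplicity : List (Triangle A) → Fin n → Fin n → ℕ
  multiplicity ts x y = ∑[ t ∈ ts ] 𝟙 (edges t x y)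

  EdgeDisjoint : List (Triangle A) → Set
  EdgeDisjoint ts = ∀ x y → multiplicity ts x y ≤ 1

  ⋃edges : List (Triangle A) → Graph n
  ⋃edges ts x y = any (λ t → edges t x y) ts

  ⋃edges-sym : ∀ ts → Symmetric (⋃edges ts)
  ⋃edges-sym ts x y = cong or (map-cong {f = λ t → edges t x y} {g = λ t → edges t y x} (λ t → clique-sym (vertices t) x y) ts)

  ⋃edges-false : ∀ ts {x y} → ⋃edges ts x y ≡ false → multiplicity ts x y ≡ 0
  ⋃edges-false []       _   = refl
  ⋃edges-false (t ∷ ts) {x} {y} ¬xy with edges t x y
  ... | false = ⋃edges-false ts {x} {y} ¬xy

  𝟙-⋃edges≤multiplicity : ∀ ts x y → 𝟙 (⋃edges ts x y) ≤ multiplicity ts x y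
  𝟙-⋃edges≤multiplicity []       x y = z≤n
  𝟙-⋃edges≤multiplicity (t ∷ ts) x y with edges t x y
  ... | true  = s≤s z≤n
  ... | false = 𝟙-⋃edges≤multiplicity ts x y

  module _ (simple : IsSimple A) where

    ⋃edges⊆A : ∀ ts → ⋃edges ts ⊆ᴳ A
    ⋃edges⊆A (t ∷ ts) x y xy∈ts with edges t x y in xy∈t
    ... | true  = edges⊆A simple t x y xy∈t
    ... | false = ⋃edges⊆A ts x y xy∈ts

    pairCount-⋃edges : ∀ ts → pairCount (⋃edges ts) ≤ 9 * length ts
    pairCount-⋃edges ts = begin
      pairCount (⋃edges ts)
        ≤⟨ ∑-mono-≤ (allFin n) (λ x → ∑-mono-≤ (allFin n) (𝟙-⋃edges≤multiplicity ts x)) ⟩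
      ∑[ x ∈ allFin n ] ∑[ y ∈ allFin n ] ∑[ t ∈ ts ] 𝟙 (edges t x y)
        ≡⟨ ∑-cong (allFin n) (λ x → ∑-comm (allFin n) ts _) ⟩
      ∑[ x ∈ allFin n ] ∑[ t ∈ ts ] ∑[ y ∈ allFin n ] 𝟙 (edges t x y)
        ≡⟨ ∑-comm (allFin n) ts _ ⟩
      ∑[ t ∈ ts ] pairCount (edges t)
        ≤⟨ ∑-mono-≤ ts (λ t → ≤-trans (pairCount-clique (vertices t))
                                      (≤-reflexive (cong (λ c → c * c) (card-vertices simple t)))) ⟩
      ∑[ _ ∈ ts ] 9
        ≡⟨ trans (∑-const ts 9) (*-comm (length ts) 9) ⟩
      9 * length ts ∎
      where open ≤-Reasoning

    record Greedy (ts : List (Triangle A)) : Set where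
      field
        disjoint : EdgeDisjoint ts
        length≤  : length ts ≤ pairCount (⋃edges ts)

    extend : ∀ {ts} → Greedy ts → ∀ {u v w} → isTriangle (removeEdges A (⋃edges ts)) u v w ≡ true →
             Σ (Triangle A) λ t → Greedy (t ∷ ts)
    extend {ts} greedy {u} {v} {w} uvw with isTri , ¬Ruv , ¬Rvw , ¬Ruw ← removeEdges-triangle {A = A} {⋃edges ts} {u} {v} {w} uvw =
      t , record { disjoint = disjoint ; length≤ = ≤-<-trans (Greedy.length≤ greedy) (pairCount-mono-< {u = u} {v} R⊆R′ ¬Ruv uv∈R′) }
      where
      t = triangle {u = u} {v} {w} isTri
      R = ⋃edges ts
      R′ = ⋃edges (t ∷ ts)
      fresh : ∀ x y → edges t x y ≡ true → R x y ≡ false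
      fresh = clique-tripleSet-elim (λ x y → R x y ≡ false) (λ {x} {y} ¬Rxy → trans (⋃edges-sym ts y x) ¬Rxy) ¬Ruv ¬Rvw ¬Ruw
      disjoint : EdgeDisjoint (t ∷ ts)
      disjoint x y with edges t x y in xy∈t
      ... | true  = ≤-reflexive (cong suc (⋃edges-false ts {x} {y} (fresh x y xy∈t)))
      ... | false = Greedy.disjoint greedy x y
      R⊆R′ : R ⊆ᴳ R′
      R⊆R′ x y Rxy = trans (cong (edges t x y ∨_) Rxy) (∨-zeroʳ _)
      uv∈R′ : R′ u v ≡ true
      uv∈R′ = cong (_∨ R u v) (edge-uv simple t)

    record Packing (εn εd : ℕ) : Set where
      field
        triangles : List (Triangle A)
        disjoint  : EdgeDisjoint triangles
        large     : εn * pairCount A ≤ εd * (9 * length triangles)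

    module _ {εn εd} (far : FarFromTriangleFree εn εd A) where

      -- Every step adds an edge to ⋃edges ts ⊆ A, so pairCount A + 1 units of fuel suffice.
      greedy : ∀ fuel ts → Greedy ts → pairCount A < length ts + fuel → Packing εn εd
      greedy zero ts g bound =
        contradiction (≤-trans (Greedy.length≤ g) (pairCount-mono (⋃edges⊆A ts))) (<⇒≱ (subst (pairCount A <_) (+-identityʳ _) bound))
      greedy (suc fuel) ts g bound with εd * pairCount (⋃edges ts) <? εn * pairCount A
      ... | no ¬small = record { triangles = ts ; disjoint = Greedy.disjoint g
                               ; large = ≤-trans (≮⇒≥ ¬small) (*-monoʳ-≤ εd (pairCount-⋃edges ts)) }
      ... | yes small with _ , _ , _ , uvw ← far (⋃edges ts) (⋃edges-sym ts) (⋃edges⊆A ts) small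
                      with t , g′ ← extend g uvw =
        greedy fuel (t ∷ ts) g′ (subst (pairCount A <_) (+-suc (length ts) fuel) bound)

      packing : Packing εn εd
      packing = greedy (suc (pairCount A)) [] (record { disjoint = λ _ _ → z≤n ; length≤ = z≤n }) ≤-refl

-- The second moment of the number of sampled packed triangles

x^3≡x*x*x : ∀ x → x ^ 3 ≡ x * x * x
x^3≡x*x*x x = trans (cong (λ y → x * (x * y)) (*-identityʳ x)) (sym (*-assoc x x x))

power-bound : ∀ m .{{_ : NonZero m}} s → s ≤ 3 → m ^ s ≤ 1 + s * m + 𝟙 (2 ≤ᵇ s) * (m * m * m)
power-bound m 0             _   = ≤-refl
power-bound m 1             _   = ≤-trans (≤-reflexive (trans (*-identityʳ m) (sym (+-identityʳ m)))) (≤-trans (m≤n+m _ 1) (m≤m+n _ 0))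
power-bound m (suc (suc s)) s≤3 = ≤-trans (^-monoʳ-≤ m s≤3)
  (≤-trans (≤-reflexive (trans (x^3≡x*x*x m) (sym (+-identityʳ (m * m * m))))) (m≤n+m _ (1 + suc (suc s) * m)))

module SecondMoment {A : Graph n} (simple : IsSimple A) (b : ℕ)
                    (ts : List (Triangle A)) (disjoint : EdgeDisjoint ts) where

  m N τ K : ℕ
  m = 2 ^ b
  N = 2 ^ (n * b)
  τ = length ts
  K = 3 * n * m + 9 * (m * m * m)

  instance
    m≢0 : NonZero m
    m≢0 = m^n≢0 2 b

  X : Vec Bool (n * b) → ℕ
  X ρ = ∑[ t ∈ ts ] 𝟙 (inSample b (vertices t) ρ)

  shared : Triangle A → Triangle A → ℕ
  shared i j = card (vertices i ∩ vertices j)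

  load : Fin n → ℕ
  load x = ∑[ t ∈ ts ] 𝟙 (vertices t x)

  load≤n : ∀ x → load x ≤ n
  load≤n x = begin
    ∑[ t ∈ ts ] 𝟙 (vertices t x)                       ≤⟨ ∑-mono-≤ ts through-edge ⟩
    ∑[ t ∈ ts ] ∑[ y ∈ allFin n ] 𝟙 (edges t x y)      ≡⟨ ∑-comm ts (allFin n) _ ⟩
    ∑[ y ∈ allFin n ] multiplicity ts x y              ≤⟨ ∑-mono-≤ (allFin n) (disjoint x) ⟩
    ∑[ _ ∈ allFin n ] 1                                ≡⟨ trans (∑-const (allFin n) 1) (trans (*-identityʳ _) (length-tabulate _)) ⟩
    n                                                  ∎
    where
    open ≤-Reasoning
    through-edge : ∀ t → 𝟙 (vertices t x) ≤ ∑[ y ∈ allFin n ] 𝟙 (edges t x y)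
    through-edge t = 𝟙≤ λ x∈t → let y , xy∈t = vertex⇒edge simple t {x} x∈t in
      ≤-trans (≤-reflexive (cong 𝟙 (sym xy∈t))) (∈⇒≤∑ (λ y → 𝟙 (edges t x y)) (∈-allFin y))

  ∑-shared≤3n : ∀ i → ∑[ j ∈ ts ] shared i j ≤ 3 * n
  ∑-shared≤3n i = begin
    ∑[ j ∈ ts ] ∑[ x ∈ allFin n ] 𝟙 (vertices i x ∧ vertices j x)
      ≡⟨ ∑-comm ts (allFin n) _ ⟩
    ∑[ x ∈ allFin n ] ∑[ j ∈ ts ] 𝟙 (vertices i x ∧ vertices j x)
      ≡⟨ ∑-cong (allFin n) factor ⟩
    ∑[ x ∈ allFin n ] (𝟙 (vertices i x) * load x)
      ≤⟨ ∑-mono-≤ (allFin n) (λ x → *-monoʳ-≤ (𝟙 (vertices i x)) (load≤n x)) ⟩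
    ∑[ x ∈ allFin n ] (𝟙 (vertices i x) * n)
      ≡⟨ trans (sym (*-distribʳ-∑ n (allFin n) _)) (cong (_* n) (card-vertices simple i)) ⟩
    3 * n ∎
    where
    open ≤-Reasoning
    factor : ∀ x → ∑[ j ∈ ts ] 𝟙 (vertices i x ∧ vertices j x) ≡ 𝟙 (vertices i x) * load x
    factor x = trans (∑-cong ts (λ j → 𝟙-∧ (vertices i x) (vertices j x)))
                     (sym (*-distribˡ-∑ (𝟙 (vertices i x)) ts (λ j → 𝟙 (vertices j x))))

  overlap⇒common-edge : ∀ i j →
                        𝟙 (2 ≤ᵇ shared i j) ≤ ∑[ x ∈ allFin n ] ∑[ y ∈ allFin n ] (𝟙 (edges i x y) * 𝟙 (edges j x y))
  overlap⇒common-edge i j = 𝟙≤ λ 2≤s →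
    let x , y , x≢y , x∈i∩j , y∈i∩j = card≥2⇒∃≢ (vertices i ∩ vertices j) (≤ᵇ⇒≤ 2 _ (Equivalence.from T-≡ 2≤s))
        xy∈i = clique⁺ (vertices i) x y (∧-conicalˡ _ _ x∈i∩j) (∧-conicalˡ _ _ y∈i∩j) x≢y
        xy∈j = clique⁺ (vertices j) x y (∧-conicalʳ _ _ x∈i∩j) (∧-conicalʳ _ _ y∈i∩j) x≢y
    in ≤-trans (≤-reflexive (cong₂ (λ p q → 𝟙 p * 𝟙 q) (sym xy∈i) (sym xy∈j)))
            (≤-trans (∈⇒≤∑ (λ y′ → 𝟙 (edges i x y′) * 𝟙 (edges j x y′)) (∈-allFin y))
                     (∈⇒≤∑ (λ x′ → ∑[ y′ ∈ allFin n ] (𝟙 (edges i x′ y′) * 𝟙 (edges j x′ y′))) (∈-allFin x)))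

  ∑-overlapping≤9 : ∀ i → ∑[ j ∈ ts ] 𝟙 (2 ≤ᵇ shared i j) ≤ 9
  ∑-overlapping≤9 i = begin
    ∑[ j ∈ ts ] 𝟙 (2 ≤ᵇ shared i j)
      ≤⟨ ∑-mono-≤ ts (overlap⇒common-edge i) ⟩
    ∑[ j ∈ ts ] ∑[ x ∈ allFin n ] ∑[ y ∈ allFin n ] (𝟙 (edges i x y) * 𝟙 (edges j x y))
      ≡⟨ trans (∑-comm ts (allFin n) _) (∑-cong (allFin n) (λ x → ∑-comm ts (allFin n) _)) ⟩
    ∑[ x ∈ allFin n ] ∑[ y ∈ allFin n ] ∑[ j ∈ ts ] (𝟙 (edges i x y) * 𝟙 (edges j x y))
      ≡⟨ ∑-cong (allFin n) (λ x → ∑-cong (allFin n) (λ y → sym (*-distribˡ-∑ (𝟙 (edges i x y)) ts _))) ⟩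
    ∑[ x ∈ allFin n ] ∑[ y ∈ allFin n ] (𝟙 (edges i x y) * multiplicity ts x y)
      ≤⟨ ∑-mono-≤ (allFin n) (λ x → ∑-mono-≤ (allFin n) (λ y →
           ≤-trans (*-monoʳ-≤ (𝟙 (edges i x y)) (disjoint x y)) (≤-reflexive (*-identityʳ _)))) ⟩
    pairCount (edges i)
      ≤⟨ pairCount-clique (vertices i) ⟩
    card (vertices i) * card (vertices i)
      ≡⟨ cong (λ c → c * c) (card-vertices simple i) ⟩
    9 ∎
    where open ≤-Reasoning

  ∑X : m ^ 3 * ∑[ ρ ∈ allVecs (n * b) ] X ρ ≡ τ * N
  ∑X = begin
    m ^ 3 * ∑[ ρ ∈ allVecs (n * b) ] ∑[ t ∈ ts ] 𝟙 (inSample b (vertices t) ρ)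
      ≡⟨ cong (m ^ 3 *_) (∑-comm (allVecs (n * b)) ts _) ⟩
    m ^ 3 * ∑[ t ∈ ts ] inSampleCount b (vertices t)
      ≡⟨ *-distribˡ-∑ (m ^ 3) ts _ ⟩
    ∑[ t ∈ ts ] (m ^ 3 * inSampleCount b (vertices t))
      ≡⟨ ∑-cong ts triangle-term ⟩
    ∑[ _ ∈ ts ] N
      ≡⟨ ∑-const ts N ⟩
    τ * N ∎
    where
    open ≡-Reasoning
    triangle-term : ∀ t → m ^ 3 * inSampleCount b (vertices t) ≡ N
    triangle-term t = trans (cong (λ c → m ^ c * inSampleCount b (vertices t)) (sym (card-vertices simple t))) (inSampleCount-≡ b (vertices t))

  pair-term : ∀ i j → m ^ 3 * m ^ 3 * inSampleCount b (vertices i ∪ vertices j) ≡ N * m ^ shared i j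
  pair-term i j = begin
    m ^ 3 * m ^ 3 * c                       ≡⟨ cong (_* c) (^-distribˡ-+-* m 3 3) ⟨
    m ^ (3 + 3) * c                         ≡⟨ cong (λ e → m ^ e * c) (sym |Ui∪Uj|+shared≡6) ⟩
    m ^ (card (Ui ∪ Uj) + shared i j) * c   ≡⟨ cong (_* c) (^-distribˡ-+-* m (card (Ui ∪ Uj)) (shared i j)) ⟩
    m ^ card (Ui ∪ Uj) * m ^ shared i j * c ≡⟨ *-assoc (m ^ card (Ui ∪ Uj)) _ c ⟩
    m ^ card (Ui ∪ Uj) * (m ^ shared i j * c) ≡⟨ x∙yz≈xz∙y (m ^ card (Ui ∪ Uj)) _ c ⟩
    m ^ card (Ui ∪ Uj) * c * m ^ shared i j ≡⟨ cong (_* m ^ shared i j) (inSampleCount-≡ b (Ui ∪ Uj)) ⟩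
    N * m ^ shared i j                      ∎
    where
    open ≡-Reasoning
    Ui = vertices i
    Uj = vertices j
    c = inSampleCount b (Ui ∪ Uj)
    |Ui∪Uj|+shared≡6 : card (Ui ∪ Uj) + shared i j ≡ 3 + 3
    |Ui∪Uj|+shared≡6 = trans (card-∪-∩ Ui Uj) (cong₂ _+_ (card-vertices simple i) (card-vertices simple j))

  X²-expand : ∀ ρ → X ρ * X ρ ≡ ∑[ i ∈ ts ] ∑[ j ∈ ts ] 𝟙 (inSample b (vertices i ∪ vertices j) ρ)
  X²-expand ρ = trans (∑-*-∑ ts ts _ _) (∑-cong ts (λ i → ∑-cong ts (λ j →
    trans (sym (𝟙-∧ (inSample b (vertices i) ρ) _)) (cong 𝟙 (sym (inSample-∪ b (vertices i) (vertices j) ρ))))))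

  row-bound : ∀ i → ∑[ j ∈ ts ] (1 + shared i j * m + 𝟙 (2 ≤ᵇ shared i j) * (m * m * m)) ≤ τ + K
  row-bound i = begin
    ∑[ j ∈ ts ] (1 + shared i j * m + 𝟙 (2 ≤ᵇ shared i j) * (m * m * m))
      ≡⟨ trans (∑-distrib-+ ts _ _) (cong₂ _+_ (∑-distrib-+ ts _ _) refl) ⟩
    ∑[ _ ∈ ts ] 1 + ∑[ j ∈ ts ] (shared i j * m) + ∑[ j ∈ ts ] (𝟙 (2 ≤ᵇ shared i j) * (m * m * m))
      ≡⟨ cong₂ _+_ (cong₂ _+_ (trans (∑-const ts 1) (*-identityʳ τ)) (sym (*-distribʳ-∑ m ts _)))
                   (sym (*-distribʳ-∑ (m * m * m) ts _)) ⟩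
    τ + ∑[ j ∈ ts ] shared i j * m + ∑[ j ∈ ts ] 𝟙 (2 ≤ᵇ shared i j) * (m * m * m)
      ≤⟨ +-mono-≤ (+-monoʳ-≤ τ (*-monoˡ-≤ m (∑-shared≤3n i))) (*-monoˡ-≤ (m * m * m) (∑-overlapping≤9 i)) ⟩
    τ + 3 * n * m + 9 * (m * m * m)
      ≡⟨ +-assoc τ _ _ ⟩
    τ + K ∎
    where open ≤-Reasoning

  ∑X² : m ^ 3 * m ^ 3 * ∑[ ρ ∈ allVecs (n * b) ] (X ρ * X ρ) ≤ N * (τ * (τ + K))
  ∑X² = begin
    m⁶ * ∑[ ρ ∈ Ω ] (X ρ * X ρ)
      ≡⟨ cong (m⁶ *_) (trans (∑-cong Ω X²-expand) (trans (∑-comm Ω ts _) (∑-cong ts (λ i → ∑-comm Ω ts _)))) ⟩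
    m⁶ * ∑[ i ∈ ts ] ∑[ j ∈ ts ] inSampleCount b (vertices i ∪ vertices j)
      ≡⟨ trans (*-distribˡ-∑ m⁶ ts _) (∑-cong ts (λ i → trans (*-distribˡ-∑ m⁶ ts _) (∑-cong ts (pair-term i)))) ⟩
    ∑[ i ∈ ts ] ∑[ j ∈ ts ] (N * m ^ shared i j)
      ≤⟨ ∑-mono-≤ ts (λ i → ∑-mono-≤ ts (λ j → *-monoʳ-≤ N (power-bound m (shared i j) (shared≤3 i j)))) ⟩
    ∑[ i ∈ ts ] ∑[ j ∈ ts ] (N * (1 + shared i j * m + 𝟙 (2 ≤ᵇ shared i j) * (m * m * m)))
      ≡⟨ trans (∑-cong ts (λ i → sym (*-distribˡ-∑ N ts _))) (sym (*-distribˡ-∑ N ts _)) ⟩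
    N * ∑[ i ∈ ts ] ∑[ j ∈ ts ] (1 + shared i j * m + 𝟙 (2 ≤ᵇ shared i j) * (m * m * m))
      ≤⟨ *-monoʳ-≤ N (∑-mono-≤ ts row-bound) ⟩
    N * ∑[ _ ∈ ts ] (τ + K)
      ≡⟨ cong (N *_) (∑-const ts (τ + K)) ⟩
    N * (τ * (τ + K)) ∎
    where
    open ≤-Reasoning
    Ω = allVecs (n * b)
    m⁶ = m ^ 3 * m ^ 3
    shared≤3 : ∀ i j → shared i j ≤ 3
    shared≤3 i j = ≤-trans (card-mono {U = vertices i ∩ vertices j} (λ x → ∧-conicalˡ _ _)) (≤-reflexive (card-vertices simple i))

  vanishing : 0 < τ → ∑[ ρ ∈ allVecs (n * b) ] 𝟙 (X ρ ≡ᵇ 0) * τ ≤ N * K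
  vanishing 0<τ = subst (λ N → ∑[ ρ ∈ allVecs (n * b) ] 𝟙 (X ρ ≡ᵇ 0) * τ ≤ N * K) (length-allVecs (n * b))
    (second-moment (allVecs (n * b)) X {m ^ 3} 0<τ
      (subst (λ N → m ^ 3 * ∑[ ρ ∈ allVecs (n * b) ] X ρ ≡ τ * N) (sym (length-allVecs (n * b))) ∑X)
      (subst (λ N → m ^ 3 * m ^ 3 * ∑[ ρ ∈ allVecs (n * b) ] (X ρ * X ρ) ≤ N * (τ * (τ + K))) (sym (length-allVecs (n * b))) ∑X²))

-- Encoding vertex pairs

bits : ℕ → ℕ → List Bool
bits zero    x = []
bits (suc w) x = (x % 2 ≡ᵇ 1) ∷ bits w (x / 2)

readBits : ℕ → List Bool → ℕ × List Bool
readBits zero    bs       = 0 , bs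
readBits (suc w) []       = 0 , []
readBits (suc w) (c ∷ bs) = let x , rest = readBits w bs in 𝟙 c + 2 * x , rest

length-bits : ∀ w x → length (bits w x) ≡ w
length-bits zero    x = refl
length-bits (suc w) x = cong suc (length-bits w (x / 2))

readBits-bits : ∀ w {x} rest → x < 2 ^ w → readBits w (bits w x ++ rest) ≡ (x , rest)
readBits-bits zero    {zero}  rest _         = refl
readBits-bits zero    {suc _} rest (s≤s ())
readBits-bits (suc w) {x}    rest x<2^[1+w]
  rewrite readBits-bits w {x / 2} rest (m<n*o⇒m/o<n (subst (x <_) (*-comm 2 (2 ^ w)) x<2^[1+w])) =
  cong (_, rest) (trans (cong₂ _+_ (𝟙-bit x) (*-comm 2 (x / 2))) (sym (m≡m%n+[m/n]*n x 2)))
  where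
  𝟙-bit : ∀ x → 𝟙 (x % 2 ≡ᵇ 1) ≡ x % 2
  𝟙-bit x with x % 2 | m%n<n x 2
  ... | 0 | _ = refl
  ... | 1 | _ = refl
  ... | suc (suc _) | s≤s (s≤s ())

toℕ² : Fin n × Fin n → ℕ × ℕ
toℕ² (x , y) = toℕ x , toℕ y

toℕ²-injective : ∀ {e e′ : Fin n × Fin n} → toℕ² e ≡ toℕ² e′ → e ≡ e′
toℕ²-injective {e = x , y} {x′ , y′} eq = cong₂ _,_ (toℕ-injective (cong proj₁ eq)) (toℕ-injective (cong proj₂ eq))

-- Words have w = ℓ + 1 > 0 bits, so no vertex pair is encoded by the empty string, where the decoder stops.
module Codec (ℓ : ℕ) (n≤2^w : n ≤ 2 ^ suc ℓ) where

  w : ℕ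
  w = suc ℓ

  encode : List (Fin n × Fin n) → List Bool
  encode []             = []
  encode ((x , y) ∷ es) = bits w (toℕ x) ++ bits w (toℕ y) ++ encode es

  decodeWith : ℕ → List Bool → List (ℕ × ℕ)
  decodeWith zero    bs       = []
  decodeWith (suc f) []       = []
  decodeWith (suc f) (c ∷ bs) = let x , bs′ = readBits w (c ∷ bs) ; y , bs″ = readBits w bs′ in (x , y) ∷ decodeWith f bs″

  decode : List Bool → List (ℕ × ℕ)
  decode bs = decodeWith (length bs) bs

  length-encode : ∀ es → length (encode es) ≡ (w + w) * length es
  length-encode []             = sym (*-zeroʳ (w + w))
  length-encode ((x , y) ∷ es) = begin
    length (bits w (toℕ x) ++ bits w (toℕ y) ++ encode es)
      ≡⟨ length-++ (bits w (toℕ x)) ⟩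
    length (bits w (toℕ x)) + length (bits w (toℕ y) ++ encode es)
      ≡⟨ cong (length (bits w (toℕ x)) +_) (length-++ (bits w (toℕ y))) ⟩
    length (bits w (toℕ x)) + (length (bits w (toℕ y)) + length (encode es))
      ≡⟨ cong₂ _+_ (length-bits w (toℕ x)) (cong₂ _+_ (length-bits w (toℕ y)) (length-encode es)) ⟩
    w + (w + (w + w) * length es)                                      ≡⟨ +-assoc w w _ ⟨
    (w + w) + (w + w) * length es                                      ≡⟨ *-suc (w + w) (length es) ⟨
    (w + w) * length ((x , y) ∷ es)                                    ∎
    where open ≡-Reasoning

  decodeWith-encode : ∀ f es → length es ≤ f → decodeWith f (encode es) ≡ map toℕ² es
  decodeWith-encode zero    []             _ = refl
  decodeWith-encode (suc f) []             _ = refl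
  decodeWith-encode (suc f) ((x , y) ∷ es) (s≤s |es|≤f) = begin
    decodeWith (suc f) (bits w (toℕ x) ++ rest)
      ≡⟨ cong (λ (x′ , bs′) → let y′ , bs″ = readBits w bs′ in (x′ , y′) ∷ decodeWith f bs″)
              (readBits-bits w {toℕ x} rest (fits x)) ⟩
    (let y′ , bs″ = readBits w rest in (toℕ x , y′) ∷ decodeWith f bs″)
      ≡⟨ cong (λ (y′ , bs″) → (toℕ x , y′) ∷ decodeWith f bs″) (readBits-bits w {toℕ y} (encode es) (fits y)) ⟩
    (toℕ x , toℕ y) ∷ decodeWith f (encode es)
      ≡⟨ cong ((toℕ x , toℕ y) ∷_) (decodeWith-encode f es |es|≤f) ⟩
    (toℕ x , toℕ y) ∷ map toℕ² es ∎
    where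
    open ≡-Reasoning
    rest = bits w (toℕ y) ++ encode es
    fits : ∀ (z : Fin n) → toℕ z < 2 ^ w
    fits z = <-≤-trans (toℕ<n z) n≤2^w

  decode-encode : ∀ es → decode (encode es) ≡ map toℕ² es
  decode-encode es = decodeWith-encode (length (encode es)) es
    (≤-trans (m≤n*m (length es) (w + w)) (≤-reflexive (sym (length-encode es))))

-- The protocol

allPairs : List (Fin n × Fin n)
allPairs {n} = cartesianProduct (allFin n) (allFin n)

∈-allPairs : ∀ (x y : Fin n) → (x , y) ∈ allPairs
∈-allPairs x y = ∈-cartesianProduct⁺ (∈-allFin x) (∈-allFin y)

edgeList : Graph n → List (Fin n × Fin n)
edgeList G = filterᵇ (λ (x , y) → G x y) allPairs

length-edgeList : ∀ (G : Graph n) → length (edgeList G) ≡ pairCount G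
length-edgeList {n} G = trans (length-filterᵇ (λ (x , y) → G x y) (allPairs {n})) (∑-cartesianProduct (allFin n) (allFin n) _)

∈-edgeList⁺ : ∀ {G : Graph n} {x y} → G x y ≡ true → (x , y) ∈ edgeList G
∈-edgeList⁺ {G = G} {x} {y} Gxy = ∈-filter⁺ (T? ∘ λ (x , y) → G x y) (∈-allPairs x y) (Equivalence.from T-≡ Gxy)

∈-edgeList⁻ : ∀ {G : Graph n} {e} → e ∈ edgeList G → G (proj₁ e) (proj₂ e) ≡ true
∈-edgeList⁻ {n} {G = G} e∈G = Equivalence.to T-≡ (proj₂ (∈-filter⁻ (T? ∘ λ (x , y) → G x y) {xs = allPairs {n}} e∈G))

allTriples : List (Fin n × Fin n × Fin n)
allTriples {n} = cartesianProduct (allFin n) allPairs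

∈-allTriples : ∀ (x y z : Fin n) → (x , y , z) ∈ allTriples
∈-allTriples x y z = ∈-cartesianProduct⁺ (∈-allFin x) (∈-allPairs y z)

module SamplingProtocol (k b ℓ M : ℕ) (n≤2^w : n ≤ 2 ^ suc ℓ) where

  open Codec ℓ n≤2^w

  send : Fin k → Graph n → Vec Bool (n * b) → List Bool
  send _ G ρ = if length (edgeList (induced b G ρ)) ≤ᵇ M then encode (edgeList (induced b G ρ)) else []

  received : (Fin k → List Bool) → List (ℕ × ℕ)
  received ms = concatMap (decode ∘ ms) (allFin k)

  heard : (Fin k → List Bool) → Graph n
  heard ms x y = does (toℕ² (x , y) ∈? received ms)

  findTriangle : Vec Bool (n * b) → (Fin k → List Bool) → Maybe (Fin n × Fin n × Fin n)
  findTriangle _ ms = findᵇ (λ (x , y , z) → isTriangle (heard ms) x y z) allTriples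

  protocol : Protocol n k
  protocol = record { r = n * b ; message = send ; referee = findTriangle }

  decode-send : ∀ j G ρ → decode (send j G ρ) ≡
                   (if length (edgeList (induced b G ρ)) ≤ᵇ M then map toℕ² (edgeList (induced b G ρ)) else [])
  decode-send j G ρ with length (edgeList (induced b G ρ)) ≤ᵇ M
  ... | true  = decode-encode (edgeList (induced b G ρ))
  ... | false = refl

  length-send : ∀ j G ρ → length (send j G ρ) ≤ (w + w) * M
  length-send j G ρ with length (edgeList (induced b G ρ)) ≤ᵇ M in fits
  ... | true  = ≤-trans (≤-reflexive (length-encode (edgeList (induced b G ρ))))
                        (*-monoʳ-≤ (w + w) (≤ᵇ⇒≤ (length (edgeList (induced b G ρ))) M (Equivalence.from T-≡ fits)))
  ... | false = z≤n

  cost≤ : ∀ E ρ → cost protocol E ρ ≤ k * ((w + w) * M)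
  cost≤ E ρ = ≤-trans (∑-mono-≤ (allFin k) (λ j → length-send j (E j) ρ))
                      (≤-reflexive (trans (∑-const (allFin k) _) (cong (_* ((w + w) * M)) (length-tabulate {n = k} (λ j → j)))))

  module _ {A : Graph n} {E : Fin k → Graph n} (valid : ValidInput A E) (ρ : Vec Bool (n * b)) where

    E⊆A : ∀ j → E j ⊆ᴳ A
    E⊆A = proj₁ (proj₂ valid)

    ms : Fin k → List Bool
    ms j = send j (E j) ρ

    heard⊆A : heard ms ⊆ᴳ A
    heard⊆A x y xy∈ms with j , xy∈j ← satisfied (∈-concatMap⁻ (decode ∘ ms) {xs = allFin k} (does⇒ (_ ∈? received ms) xy∈ms))
      with length (edgeList (induced b (E j) ρ)) ≤ᵇ M | decode-send j (E j) ρ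
    ... | true | dec-ms rewrite dec-ms with e , e∈Ej , e≡xy ← ∈-map⁻ toℕ² xy∈j =
      E⊆A j x y (∧-conicalˡ _ _
        (subst (λ (x , y) → induced b (E j) ρ x y ≡ true) (toℕ²-injective (sym e≡xy)) (∈-edgeList⁻ e∈Ej)))
    ... | false | dec-ms rewrite dec-ms with () ← xy∈j

    A⊆heard : pairCount (induced b A ρ) ≤ M → induced b A ρ ⊆ᴳ heard ms
    A⊆heard few x y xy∈A with j , Ejxy ← proj₂ (proj₂ valid) x y (∧-conicalˡ _ _ xy∈A) =
      dec-true (_ ∈? received ms) (∈-concatMap⁺ (decode ∘ ms) (lose (∈-allFin j) xy∈j))
      where
      few-j : length (edgeList (induced b (E j) ρ)) ≤ M
      few-j = ≤-trans (≤-reflexive (length-edgeList (induced b (E j) ρ))) (≤-trans (pairCount-mono (induced⊆ b ρ (E⊆A j))) few)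
      xy∈j : toℕ² (x , y) ∈ decode (ms j)
      xy∈j rewrite decode-send j (E j) ρ | Equivalence.to T-≡ (≤⇒≤ᵇ few-j) =
        ∈-map⁺ toℕ² (∈-edgeList⁺ (cong₂ _∧_ Ejxy (∧-conicalʳ _ _ xy∈A)))

    heard-sampled : pairCount (induced b A ρ) ≤ M → ∀ {x y} → A x y ≡ true →
                    inSample b ⁅ x ⁆ ρ ≡ true → inSample b ⁅ y ⁆ ρ ≡ true → heard ms x y ≡ true
    heard-sampled few {x} {y} Axy x∈S y∈S =
      A⊆heard few x y (cong₂ _∧_ Axy (trans (inSample-∪ b ⁅ x ⁆ ⁅ y ⁆ ρ) (cong₂ _∧_ x∈S y∈S)))

    success : pairCount (induced b A ρ) ≤ M → (t : Triangle A) → inSample b (vertices t) ρ ≡ true →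
              outputsTriangle A (run protocol E ρ) ≡ true
    success few (triangle {u} {v} {w} uvw) uvw∈S
      with Auv , Avw , Auw ← isTriangle⁻ A uvw
      with u∈S , vw∈S ← ∧-true⁻ (trans (sym (inSample-∪ b ⁅ u ⁆ (pairSet v w) ρ)) uvw∈S)
      with v∈S , w∈S ← ∧-true⁻ (trans (sym (inSample-∪ b ⁅ v ⁆ ⁅ w ⁆ ρ)) vw∈S)
      with _ , found ← findᵇ-complete (λ (x , y , z) → isTriangle (heard ms) x y z) (∈-allTriples u v w)
                         (cong₂ _∧_ (heard-sampled few Auv u∈S v∈S)
                                    (cong₂ _∧_ (heard-sampled few Avw v∈S w∈S) (heard-sampled few Auw u∈S w∈S)))
      rewrite found = isTriangle-mono heard⊆A (findᵇ-sound _ allTriples found)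

-- Choice of parameters

n<2^[1+⌊log₂n⌋] : ∀ n → n < 2 ^ suc ⌊log₂ n ⌋
n<2^[1+⌊log₂n⌋] n = ≰⇒> λ 2^[1+⌊log₂n⌋]≤n →
  1+n≰n (subst (_≤ ⌊log₂ n ⌋) (⌊log₂[2^n]⌋≡n (suc ⌊log₂ n ⌋)) (⌊log₂⌋-mono-≤ 2^[1+⌊log₂n⌋]≤n))

cube-cancel-≤ : ∀ {x y} → x * x * x ≤ y * y * y → x ≤ y
cube-cancel-≤ {x} {y} x³≤y³ with x ≤? y
... | yes x≤y = x≤y
... | no  x≰y = contradiction x³≤y³ (<⇒≱ (*-mono-< (*-mono-< y<x y<x) y<x))
  where y<x = ≰⇒> x≰y

block-size : ∀ {L D} → 0 < L → L < D → ∃ λ b → D ≤ L * (2 ^ b * 2 ^ b * 2 ^ b) × L * (2 ^ b * 2 ^ b * 2 ^ b) ≤ 8 * D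
block-size {L} {D} 0<L L<D = search (suc ⌊log₂ D ⌋) D≤L*x³
  where
  x = 2 ^ suc ⌊log₂ D ⌋
  D≤L*x³ : D ≤ L * (x * x * x)
  D≤L*x³ = begin
    D                  ≤⟨ <⇒≤ (n<2^[1+⌊log₂n⌋] D) ⟩
    x                  ≡⟨ *-identityʳ x ⟨
    x ^ 1              ≤⟨ ^-monoʳ-≤ x {{m^n≢0 2 (suc ⌊log₂ D ⌋)}} {1} {3} (s≤s z≤n) ⟩
    x ^ 3              ≡⟨ x^3≡x*x*x x ⟩
    x * x * x          ≤⟨ m≤n*m _ L {{>-nonZero 0<L}} ⟩
    L * (x * x * x)    ∎
    where open ≤-Reasoning
  search : ∀ j → D ≤ L * (2 ^ j * 2 ^ j * 2 ^ j) → ∃ λ b → D ≤ L * (2 ^ b * 2 ^ b * 2 ^ b) × L * (2 ^ b * 2 ^ b * 2 ^ b) ≤ 8 * D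
  search zero    D≤L = contradiction (≤-trans D≤L (≤-reflexive (*-identityʳ L))) (<⇒≱ L<D)
  search (suc j) D≤L*[2^[1+j]]³ with D ≤? L * (2 ^ j * 2 ^ j * 2 ^ j)
  ... | yes D≤L*[2^j]³ = search j D≤L*[2^j]³
  ... | no  D≰L*[2^j]³ =
    suc j , D≤L*[2^[1+j]]³ , ≤-trans (≤-reflexive (eight-fold L (2 ^ j))) (*-monoʳ-≤ 8 (<⇒≤ (≰⇒> D≰L*[2^j]³)))
    where
    eight-fold : ∀ l y → l * (2 * y * (2 * y) * (2 * y)) ≡ 8 * (l * (y * y * y))
    eight-fold = solve-∀

-- Both error terms of the second moment are small: 3nm because n³ ≤ cd² D² (the average degree is at least
-- about √n), and 9m³ because L m³ ≤ 8D.
error-terms≤ : ∀ a cd n m D L → 8 * (cd * cd) * (108 * a * (108 * a) * (108 * a)) ≤ L → 2592 * a ≤ L → 0 < L →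
               L * (m * m * m) ≤ 8 * D → n * n * n ≤ cd * cd * (D * D) →
               18 * a * (3 * n * m + 9 * (m * m * m)) ≤ D
error-terms≤ a cd n m D L L₁≤L L₂≤L 0<L Lm³≤8D n³≤cd²D² = *-cancelˡ-≤ 2 (begin
  2 * (18 * a * (3 * n * m + 9 * (m * m * m)))  ≡⟨ split a n m ⟩
  108 * a * n * m + 324 * a * (m * m * m)       ≤⟨ +-mono-≤ nm-term m³-term ⟩
  D + D                                          ≡⟨ cong (D +_) (+-identityʳ D) ⟨
  2 * D                                          ∎)
  where
  open ≤-Reasoning
  c = 108 * a * (108 * a) * (108 * a)
  split : ∀ a n m → 2 * (18 * a * (3 * n * m + 9 * (m * m * m))) ≡ 108 * a * n * m + 324 * a * (m * m * m)
  split = solve-∀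
  m³-term : 324 * a * (m * m * m) ≤ D
  m³-term = *-cancelˡ-≤ 8 (begin
    8 * (324 * a * (m * m * m))  ≡⟨ eight a (m * m * m) ⟩
    2592 * a * (m * m * m)       ≤⟨ *-monoˡ-≤ (m * m * m) L₂≤L ⟩
    L * (m * m * m)              ≤⟨ Lm³≤8D ⟩
    8 * D                        ∎)
    where
    eight : ∀ a x → 8 * (324 * a * x) ≡ 2592 * a * x
    eight = solve-∀
  nm-term : 108 * a * n * m ≤ D
  nm-term = cube-cancel-≤ (*-cancelˡ-≤ L {{>-nonZero 0<L}} (begin
    L * (108 * a * n * m * (108 * a * n * m) * (108 * a * n * m))  ≡⟨ expand a n m L ⟩
    c * (n * n * n) * (L * (m * m * m))                            ≤⟨ *-mono-≤ (*-monoʳ-≤ c n³≤cd²D²) Lm³≤8D ⟩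
    c * (cd * cd * (D * D)) * (8 * D)                              ≡⟨ collect c cd D ⟩
    8 * (cd * cd) * c * (D * D * D)                                ≤⟨ *-monoˡ-≤ (D * D * D) L₁≤L ⟩
    L * (D * D * D)                                                ∎))
    where
    expand : ∀ a n m L → L * (108 * a * n * m * (108 * a * n * m) * (108 * a * n * m))
                         ≡ 108 * a * (108 * a) * (108 * a) * (n * n * n) * (L * (m * m * m))
    expand = solve-∀
    collect : ∀ c e D → c * (e * e * (D * D)) * (8 * D) ≡ 8 * (e * e) * c * (D * D * D)
    collect = solve-∀

overflow-rare : ∀ {Y δd δn L m D N} → 0 < δn → 0 < D → D ≤ L * (m * m * m) →
                Y * suc (2 * δd * L * m) * (m * m) ≤ D * N → 2 * δd * Y ≤ δn * N
overflow-rare {Y} {δd} {δn} {L} {m} {D} {N} 0<δn 0<D D≤Lm³ overflow =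
  ≤-trans (*-cancelʳ-≤ (2 * δd * Y) N D {{>-nonZero 0<D}} (begin
    2 * δd * Y * D                    ≤⟨ *-monoʳ-≤ (2 * δd * Y) D≤Lm³ ⟩
    2 * δd * Y * (L * (m * m * m))    ≡⟨ regroup δd Y L m ⟩
    Y * (2 * δd * L * m) * (m * m)    ≤⟨ *-monoˡ-≤ (m * m) (*-monoʳ-≤ Y (n≤1+n _)) ⟩
    Y * suc (2 * δd * L * m) * (m * m) ≤⟨ overflow ⟩
    D * N                             ≡⟨ *-comm D N ⟩
    N * D                             ∎))
  (m≤n*m N δn {{>-nonZero 0<δn}})
  where
  open ≤-Reasoning
  regroup : ∀ δd Y L m → 2 * δd * Y * (L * (m * m * m)) ≡ Y * (2 * δd * L * m) * (m * m)
  regroup = solve-∀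

vanishing-rare : ∀ {Z τ N K D εn εd δd δn} → 0 < εn → 0 < D → 0 < δn →
                 Z * τ ≤ N * K → εn * D ≤ εd * (9 * τ) → 18 * (δd * εd) * K ≤ D → 2 * δd * Z ≤ δn * N
vanishing-rare {Z} {τ} {N} {K} {D} {εn} {εd} {δd} {δn} 0<εn 0<D 0<δn Zτ≤NK εnD≤9εdτ K≤D =
  *-cancelʳ-≤ (2 * δd * Z) (δn * N) (εn * D) {{>-nonZero (*-mono-≤ 0<εn 0<D)}} (begin
    2 * δd * Z * (εn * D)        ≤⟨ *-monoʳ-≤ (2 * δd * Z) εnD≤9εdτ ⟩
    2 * δd * Z * (εd * (9 * τ))  ≡⟨ regroup δd Z εd τ ⟩
    18 * (δd * εd) * (Z * τ)     ≤⟨ *-monoʳ-≤ (18 * (δd * εd)) Zτ≤NK ⟩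
    18 * (δd * εd) * (N * K)     ≡⟨ x∙yz≈y∙xz (18 * (δd * εd)) N K ⟩
    N * (18 * (δd * εd) * K)     ≤⟨ *-monoʳ-≤ N K≤D ⟩
    N * D                        ≤⟨ *-mono-≤ (m≤n*m N δn {{>-nonZero 0<δn}}) (m≤n*m D εn {{>-nonZero 0<εn}}) ⟩
    δn * N * (εn * D)            ∎)
  where
  open ≤-Reasoning
  regroup : ∀ δd Z εd τ → 2 * δd * Z * (εd * (9 * τ)) ≡ 18 * (δd * εd) * (Z * τ)
  regroup = solve-∀

union-bound : ∀ {N S Z Y δd δn} → N ≤ S + Z + Y → 2 * δd * Z ≤ δn * N → 2 * δd * Y ≤ δn * N →
              δd * N ≤ δd * S + δn * N
union-bound {N} {S} {Z} {Y} {δd} {δn} N≤S+Z+Y Z-rare Y-rare = begin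
  δd * N                      ≤⟨ *-monoʳ-≤ δd N≤S+Z+Y ⟩
  δd * (S + Z + Y)            ≡⟨ distribute δd S Z Y ⟩
  δd * S + (δd * Z + δd * Y)  ≤⟨ +-monoʳ-≤ (δd * S) (*-cancelˡ-≤ 2 (begin
    2 * (δd * Z + δd * Y)       ≡⟨ double δd Z Y ⟩
    2 * δd * Z + 2 * δd * Y     ≤⟨ +-mono-≤ Z-rare Y-rare ⟩
    δn * N + δn * N             ≡⟨ cong (δn * N +_) (+-identityʳ (δn * N)) ⟨
    2 * (δn * N)                ∎)) ⟩
  δd * S + δn * N             ∎
  where
  open ≤-Reasoning
  distribute : ∀ δd S Z Y → δd * (S + Z + Y) ≡ δd * S + (δd * Z + δd * Y)
  distribute = solve-∀
  double : ∀ δd Z Y → 2 * (δd * Z + δd * Y) ≡ 2 * δd * Z + 2 * δd * Y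
  double = solve-∀

cost-cube : ∀ {c k lg δd L m D} → 1 ≤ lg → c ≤ k * ((suc lg + suc lg) * (2 * δd * L * m)) → L * (m * m * m) ≤ 8 * D →
            c * c * c ≤ 4096 * (δd * δd * δd) * (L * L) * (k * k * k) * D * (lg * lg * lg)
cost-cube {c} {k} {lg} {δd} {L} {m} {D} 1≤lg c≤ Lm³≤8D = begin
  c * c * c                                                     ≤⟨ *-mono-≤ (*-mono-≤ c≤′ c≤′) c≤′ ⟩
  y * y * y                                                     ≡⟨ expand k lg δd L m ⟩
  512 * (δd * δd * δd) * (L * L) * (k * k * k) * (lg * lg * lg) * (L * (m * m * m))
                                                                ≤⟨ *-monoʳ-≤ (512 * (δd * δd * δd) * (L * L) * (k * k * k) * (lg * lg * lg)) Lm³≤8D ⟩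
  512 * (δd * δd * δd) * (L * L) * (k * k * k) * (lg * lg * lg) * (8 * D)
                                                                ≡⟨ collect δd L k lg D ⟩
  4096 * (δd * δd * δd) * (L * L) * (k * k * k) * D * (lg * lg * lg) ∎
  where
  open ≤-Reasoning
  y = k * (4 * lg * (2 * δd * L * m))
  2+2lg≤4lg : suc lg + suc lg ≤ 4 * lg
  2+2lg≤4lg = ≤-trans (≤-reflexive (two lg)) (≤-trans (+-monoˡ-≤ (2 * lg) (*-monoʳ-≤ 2 1≤lg)) (≤-reflexive (four lg)))
    where
    two : ∀ l → suc l + suc l ≡ 2 * 1 + 2 * l
    two = solve-∀
    four : ∀ l → 2 * l + 2 * l ≡ 4 * l
    four = solve-∀
  c≤′ : c ≤ y
  c≤′ = ≤-trans c≤ (*-monoʳ-≤ k (*-monoˡ-≤ (2 * δd * L * m) 2+2lg≤4lg))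
  expand : ∀ k lg δd L m → k * (4 * lg * (2 * δd * L * m)) * (k * (4 * lg * (2 * δd * L * m))) * (k * (4 * lg * (2 * δd * L * m)))
                           ≡ 512 * (δd * δd * δd) * (L * L) * (k * k * k) * (lg * lg * lg) * (L * (m * m * m))
  expand = solve-∀
  collect : ∀ δd L k lg D → 512 * (δd * δd * δd) * (L * L) * (k * k * k) * (lg * lg * lg) * (8 * D)
                           ≡ 4096 * (δd * δd * δd) * (L * L) * (k * k * k) * D * (lg * lg * lg)
  collect = solve-∀

large⇒nonempty : ∀ {εn εd D τ} → 0 < εn → 0 < D → εn * D ≤ εd * (9 * τ) → 0 < τ
large⇒nonempty {εn} {εd} {D} {zero}  0<εn 0<D εnD≤0 =
  contradiction (≤-trans εnD≤0 (≤-reflexive (*-zeroʳ εd))) (<⇒≱ (*-mono-≤ 0<εn 0<D))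
large⇒nonempty {τ = suc _} _ _ _ = s≤s z≤n

module Construction (εn εd δn δd cd : ℕ) (0<εn : 0 < εn) (0<δn : 0 < δn) (0<a : 0 < δd * εd) where

  a L₁ L₂ L C N₀ : ℕ
  a  = δd * εd
  -- L₁ and L₂ are the lower bounds on L required by error-terms≤.
  L₁ = 8 * (cd * cd) * (108 * a * (108 * a) * (108 * a))
  L₂ = 2592 * a
  L  = L₁ + L₂
  C  = 4096 * (δd * δd * δd) * (L * L)
  N₀ = cd * cd * (L * L) + 2

  L₁≤L : L₁ ≤ L
  L₁≤L = m≤m+n L₁ L₂

  L₂≤L : L₂ ≤ L
  L₂≤L = m≤n+m L₂ L₁

  0<L : 0 < L
  0<L = ≤-trans (≤-trans 0<a (m≤n*m a 2592)) L₂≤L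

  module Instance {n} (k D : ℕ) (N₀≤n : N₀ ≤ n) (dense : n * n * n ≤ cd * cd * (D * D)) where

    2≤n : 2 ≤ n
    2≤n = ≤-trans (m≤n+m 2 _) N₀≤n

    L<D : L < D
    L<D = ≰⇒> λ D≤L → contradiction dense (<⇒≱ (begin-strict
      cd * cd * (D * D)  ≤⟨ *-monoʳ-≤ (cd * cd) (*-mono-≤ D≤L D≤L) ⟩
      cd * cd * (L * L)  <⟨ ≤-trans (≤-reflexive (+-comm 1 _)) (+-monoʳ-≤ _ (s≤s z≤n)) ⟩
      N₀                 ≤⟨ N₀≤n ⟩
      n                  ≤⟨ m≤n*m n (n * n) {{>-nonZero (*-mono-≤ (≤-trans (s≤s z≤n) 2≤n) (≤-trans (s≤s z≤n) 2≤n))}} ⟩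
      n * n * n          ∎))
      where open ≤-Reasoning

    0<D : 0 < D
    0<D = ≤-trans (s≤s z≤n) L<D

    b m M : ℕ
    b = proj₁ (block-size 0<L L<D)
    m = 2 ^ b
    M = 2 * δd * L * m

    D≤Lm³ : D ≤ L * (m * m * m)
    D≤Lm³ = proj₁ (proj₂ (block-size 0<L L<D))

    Lm³≤8D : L * (m * m * m) ≤ 8 * D
    Lm³≤8D = proj₂ (proj₂ (block-size 0<L L<D))

    open SamplingProtocol {n} k b ⌊log₂ n ⌋ M (<⇒≤ (n<2^[1+⌊log₂n⌋] n)) public

    cost-bound : ∀ E ρ → cost protocol E ρ * cost protocol E ρ * cost protocol E ρ
                         ≤ C * (k * k * k) * D * (⌊log₂ n ⌋ * ⌊log₂ n ⌋ * ⌊log₂ n ⌋)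
    cost-bound E ρ = cost-cube {k = k} {δd = δd} {L} {m} {D} (⌊log₂⌋-mono-≤ 2≤n) (cost≤ E ρ) Lm³≤8D

    success-bound : ∀ A E → IsSimple A → pairCount A ≡ D → ValidInput A E → FarFromTriangleFree εn εd A →
                    δd * 2 ^ r protocol ≤ δd * successCount protocol A E + δn * 2 ^ r protocol
    success-bound A E simple |A|≡D valid far = union-bound {S = successCount protocol A E} {δd = δd} {δn} N≤S+Z+Y Z-rare Y-rare
      where
      open Packing (packing simple {εn} {εd} far)
      open SecondMoment simple b triangles disjoint using (X; vanishing)
      Ω = allVecs (n * b)
      succeeds vanishes overflows : Vec Bool (n * b) → Bool
      succeeds ρ  = outputsTriangle A (run protocol E ρ)
      vanishes ρ  = X ρ ≡ᵇ 0
      overflows ρ = M <ᵇ pairCount (induced b A ρ)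

      large′ : εn * D ≤ εd * (9 * length triangles)
      large′ = subst (λ D → εn * D ≤ εd * (9 * length triangles)) |A|≡D large

      Z-rare : 2 * δd * ∑ Ω (𝟙 ∘ vanishes) ≤ δn * 2 ^ (n * b)
      Z-rare = vanishing-rare {εd = εd} {δd} 0<εn 0<D 0<δn (vanishing (large⇒nonempty {εd = εd} 0<εn 0<D large′)) large′
                 (error-terms≤ a cd n m D L L₁≤L L₂≤L 0<L Lm³≤8D dense)

      Y-rare : 2 * δd * ∑ Ω (𝟙 ∘ overflows) ≤ δn * 2 ^ (n * b)
      Y-rare = overflow-rare {δd = δd} {L = L} {m} 0<δn 0<D D≤Lm³
                 (subst (λ D → ∑ Ω (𝟙 ∘ overflows) * suc M * (m * m) ≤ D * 2 ^ (n * b)) |A|≡D (overflow-bound b A (proj₂ simple) M))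

      some-outcome : ∀ ρ → 1 ≤ 𝟙 (succeeds ρ) + 𝟙 (vanishes ρ) + 𝟙 (overflows ρ)
      some-outcome ρ = 𝟙-cover λ ¬vanishes ¬overflows →
        let t , t∈S = ∑𝟙-pos⇒∃ triangles (λ t → inSample b (vertices t) ρ) (≡ᵇ0-false⇒pos ¬vanishes)
        in success valid ρ (<ᵇ-false⇒≤ ¬overflows) t t∈S

      N≤S+Z+Y : 2 ^ (n * b) ≤ successCount protocol A E + ∑ Ω (𝟙 ∘ vanishes) + ∑ Ω (𝟙 ∘ overflows)
      N≤S+Z+Y = begin
        2 ^ (n * b)   ≡⟨ trans (sym (length-allVecs (n * b))) (trans (sym (*-identityʳ _)) (sym (∑-const Ω 1))) ⟩
        ∑[ _ ∈ Ω ] 1  ≤⟨ ∑-mono-≤ Ω some-outcome ⟩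
        ∑[ ρ ∈ Ω ] (𝟙 (succeeds ρ) + 𝟙 (vanishes ρ) + 𝟙 (overflows ρ))
                      ≡⟨ trans (∑-distrib-+ Ω (λ ρ → 𝟙 (succeeds ρ) + 𝟙 (vanishes ρ)) (𝟙 ∘ overflows))
                               (cong (_+ ∑ Ω (𝟙 ∘ overflows)) (∑-distrib-+ Ω (𝟙 ∘ succeeds) (𝟙 ∘ vanishes))) ⟩
        ∑ Ω (𝟙 ∘ succeeds) + ∑ Ω (𝟙 ∘ vanishes) + ∑ Ω (𝟙 ∘ overflows) ∎
        where open ≤-Reasoning

mainTheorem7 : (εn εd δn δd cn cd : ℕ) → 0 < εn → 0 < εd → 0 < δn → 0 < δd → 0 < cn → 0 < cd →
    (p q : ℕ → ℕ) → (∀ n → 0 < q n) → Vanishing p q →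
    Σ ℕ λ C → Σ ℕ λ N₀ →
    ∀ (n : ℕ) → N₀ ≤ n → ∀ (k : ℕ) → 1 ≤ k → ∀ (D : ℕ) →
    cn * cn * (n * n * n) ≤ cd * cd * (D * D) →
    D ^ q n * n ^ p n ≤ n ^ (2 * q n) →
    Σ (Protocol n k) λ P →
    ∀ (A : Graph n) (E : Fin k → Graph n) → IsSimple A → pairCount A ≡ D → ValidInput A E →
    ((∀ ρ → cost P E ρ * cost P E ρ * cost P E ρ
    ≤ C * (k * k * k) * D * (⌊log₂ n ⌋ * ⌊log₂ n ⌋ * ⌊log₂ n ⌋))
    × (FarFromTriangleFree εn εd A →
    δd * 2 ^ r P ≤ δd * successCount P A E + δn * 2 ^ r P))
mainTheorem7 εn εd δn δd cn cd 0<εn 0<εd 0<δn 0<δd 0<cn _ _ _ _ _ =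
  C , N₀ , λ n N₀≤n k _ D cn²n³≤cd²D² _ →
    let open Instance {n} k D N₀≤n (≤-trans (m≤n*m _ (cn * cn) {{>-nonZero (*-mono-≤ 0<cn 0<cn)}}) cn²n³≤cd²D²)
    in protocol , λ A E simple |A|≡D valid → cost-bound E , success-bound A E simple |A|≡D valid
  where open Construction εn εd δn δd cd 0<εn 0<δn (*-mono-≤ 0<δd 0<εd)
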